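{- Let $G$ be a graph of even order $\nu$ and let $k$ be a positive integer such that $\nu/4\leq k\leq \nu/2-1$ and $\delta(G)\geq \nu/2+k-1$. Suppose that $G$ cannot be expressed as $G=G_0\vee(G_1\cup G_2)$ where $\nu/2-k$ is odd, $G_0$ has $2k$ vertices and $G_1=G_2=K_{\nu/2-k}$. Then the following are equivalent: (1) $G$ is $k$-extendable; (2) $G$ is $2k$-factor-critical; (3) $\alpha(G)\leq \nu/2-k$.
   Context: All graphs are undirected, simple, finite and connected. $\delta(G)$ is the minimum degree and $\alpha(G)$ the independence number of $G$. A connected graph $G$ on $\nu$ vertices is $k$-extendable if it contains a matching of size $k$ and every matching of size $k$ in $G$ is contained in a perfect matching of $G$. A graph $G$ is $n$-factor-critical if $G-S$ has a perfect matching for every $S\subseteq V(G)$ with $|S|=n$. For disjoint graphs $G_1,G_2$, the union $G_1\cup G_2$ has vertex set $V(G_1)\cup V(G_2)$ and edge set $E(G_1)\cup E(G_2)$; the join $G_1\vee G_2$ is obtained from $G_1\cup G_2$ by joining every vertex of $G_1$ to every vertex of $G_2$. $K_m$ is the complete graph on $m$ vertices. -}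

module Defs where

open import Data.Nat using (ℕ; zero; suc; _+_; _*_; _∸_; _≤_; _<_)
open import Data.Nat.Properties using ()
open import Data.Bool using (Bool; true; false)
open import Data.Fin using (Fin)
open import Data.Fin.Subset using (Subset; ∣_∣) renaming (_∈_ to _∈ₛ_; _∉_ to _∉ₛ_)
open import Data.Vec using (tabulate)
open import Data.List using (List; []; _∷_; length; concatMap)
open import Data.List.Relation.Unary.All using (All)
open import Data.List.Relation.Unary.Unique.Propositional using (Unique)
open import Data.List.Membership.Propositional using (_∈_)
open import Data.Product using (Σ; ∃; ∃-syntax; _×_; _,_; proj₁; proj₂)
open import Data.Sum using (_⊎_)
open import Relation.Binary.PropositionalEquality using (_≡_; _≢_)
open import Relation.Nullary using (¬_)

record Graph (n : ℕ) : Set where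
  field
    adj   : Fin n → Fin n → Bool
    sym   : ∀ u v → adj u v ≡ adj v u
    irrefl : ∀ v → adj v v ≡ false
open Graph public

Odd : ℕ → Set
Odd m = ∃[ t ] (m ≡ suc (2 * t))

module _ {n : ℕ} (G : Graph n) where

  Edge : Fin n → Fin n → Set
  Edge u v = adj G u v ≡ true

  data Reach : Fin n → Fin n → Set where
    here : ∀ {v} → Reach v v
    step : ∀ {u w v} → Edge u w → Reach w v → Reach u v

  Connected : Set
  Connected = ∀ u v → Reach u v

  nbhd : Fin n → Subset n
  nbhd v = tabulate (λ w → adj G v w)

  degree : Fin n → ℕ
  degree v = ∣ nbhd v ∣

  MinDegreeAtLeast : ℕ → Set
  MinDegreeAtLeast d = ∀ v → d ≤ degree v

  verts : List (Fin n × Fin n) → List (Fin n)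
  verts = concatMap (λ e → proj₁ e ∷ proj₂ e ∷ [])

  IsMatching : List (Fin n × Fin n) → Set
  IsMatching M = All (λ e → Edge (proj₁ e) (proj₂ e)) M × Unique (verts M)

  IsPerfectMatching : List (Fin n × Fin n) → Set
  IsPerfectMatching M = IsMatching M × (∀ v → v ∈ verts M)

  _⊆ₘ_ : List (Fin n × Fin n) → List (Fin n × Fin n) → Set
  M ⊆ₘ P = ∀ {u v} → (u , v) ∈ M → ((u , v) ∈ P ⊎ (v , u) ∈ P)

  -- k-extendable (connectedness is part of the definition)
  Extendable : ℕ → Set
  Extendable k =
    Connected
    × (∃[ M ] (IsMatching M × length M ≡ k))
    × (∀ M → IsMatching M → length M ≡ k →
         ∃[ P ] (IsPerfectMatching P × M ⊆ₘ P))

  HasPerfectMatchingAvoiding : Subset n → Set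
  HasPerfectMatchingAvoiding S =
    ∃[ M ] (IsMatching M
            × All (λ v → v ∉ₛ S) (verts M)
            × (∀ v → v ∉ₛ S → v ∈ verts M))

  FactorCritical : ℕ → Set
  FactorCritical m = ∀ (S : Subset n) → ∣ S ∣ ≡ m → HasPerfectMatchingAvoiding S

  Independent : Subset n → Set
  Independent I = ∀ u v → u ∈ₛ I → v ∈ₛ I → adj G u v ≡ false

  IndependenceNumberAtMost : ℕ → Set
  IndependenceNumberAtMost m = ∀ (I : Subset n) → Independent I → ∣ I ∣ ≤ m

  -- G = G₀ ∨ (K_r ∪ K_r) with |V(G₀)| = a : vertices labelled
  -- 0 (for G₀), 1 (first K_r), 2 (second K_r).
  IsJoinOfTwoCliques : (a r : ℕ) → Set
  IsJoinOfTwoCliques a r =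
    Σ (Fin n → Fin 3) λ f →
        ∣ tabulate (λ v → isLabel f 0F v) ∣ ≡ a
      × ∣ tabulate (λ v → isLabel f 1F v) ∣ ≡ r
      × ∣ tabulate (λ v → isLabel f 2F v) ∣ ≡ r
      × (∀ u v → u ≢ v → f u ≡ f v → f u ≢ 0F → Edge u v)
      × (∀ u v → f u ≡ 1F → f v ≡ 2F → adj G u v ≡ false)
      × (∀ u v → f u ≡ 0F → f v ≢ 0F → Edge u v)
    where
      open import Data.Fin using (zero; suc)
      open import Data.Fin.Properties using (_≟_)
      open import Relation.Nullary using (does)
      0F 1F 2F : Fin 3
      0F = zero
      1F = suc zero
      2F = suc (suc zero)
      isLabel : (Fin n → Fin 3) → Fin 3 → Fin n → Bool
      isLabel f i v = does (f v ≟ i)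

-- Write m = h − k, so that ν = 2k + 2m with 1 ≤ m ≤ k, and the degree bound says that every
-- vertex has at most m + 1 non-neighbours, itself included.
--
-- If α ≤ m, the 2m vertices outside any 2k-set S carry a perfect matching: a smaller matching
-- there admitting no augmenting path of length 1, 3 or 5 forces, by counting non-neighbours,
-- either m + 1 independent vertices or the excluded join G₀ ∨ (K_m ∪ K_m) with m odd. So G is
-- 2k-factor-critical, and then k-extendable by deleting the vertices of a k-matching.
--
-- Conversely, given m + 1 independent vertices T, a greedy k-matching exists outside T, and it
-- extends to no perfect matching: T would need m + 1 partners among the m − 1 vertices left.

module Submission where

open import Defs
open import Data.Nat using (ℕ; _+_; _*_; _∸_; _≤_; _<_)
open import Data.Product using (_×_)
open import Relation.Binary.PropositionalEquality using (_≡_)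
open import Relation.Nullary using (¬_)

open import Data.Bool using (Bool; true; false; _∧_; _∨_; not)
open import Data.Bool.Properties using (¬-not; ∧-zeroʳ; ∧-identityʳ; ∨-identityʳ; not-involutive) renaming (_≟_ to _≟B_)
open import Data.Empty using (⊥; ⊥-elim)
open import Data.Fin using (Fin) renaming (zero to fz; suc to fs)
import Data.Fin.Properties as Fin
open import Data.Fin.Properties using (any?) renaming (_≟_ to _≟F_)
open import Data.Fin.Subset using (Subset; ∣_∣) renaming (_∈_ to _∈ₛ_)
open import Data.List using (List; []; _∷_; _++_; length; allFin)
import Data.List as L
import Data.List.Properties as Lₚ
open import Data.List.Membership.Propositional using (_∈_; _∉_)
import Data.List.Membership.Propositional.Properties as MP
import Data.List.Membership.DecPropositional as DecMembership
open import Data.List.Relation.Binary.Permutation.Propositional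
  using (_↭_; ↭-sym; prep; swap; ↭-reflexive; ↭⇒↭ₛ) renaming (refl to ↭-refl; trans to ↭-trans)
import Data.List.Relation.Binary.Permutation.Propositional.Properties as PP
import Data.List.Relation.Binary.Permutation.Setoid.Properties as ↭ₛ
open import Data.List.Relation.Unary.All using (All; []; _∷_)
import Data.List.Relation.Unary.All as All
import Data.List.Relation.Unary.All.Properties as AllP
open import Data.List.Relation.Unary.AllPairs using ([]; _∷_)
open import Data.List.Relation.Unary.Any using (here; there)
open import Data.List.Relation.Unary.Unique.Propositional using (Unique)
import Data.List.Relation.Unary.Unique.Propositional.Properties as UP
open import Data.Nat using (zero; suc; z≤n; s≤s; s≤s⁻¹; _≤?_)
open import Data.Nat.Properties
open import Algebra.Properties.CommutativeSemigroup +-commutativeSemigroup using (interchange)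
open import Data.Nat.Tactic.RingSolver using (solve-∀)
open import Data.Product using (Σ; ∃-syntax; _,_; proj₁; proj₂)
import Data.Product.Properties as Product
open import Data.Sum using (_⊎_; inj₁; inj₂)
open import Data.Vec using (tabulate; lookup)
import Data.Vec.Properties as Vec
open import Function using (_∘_; id)
open import Relation.Nullary using (Dec; yes; no; does)
open import Relation.Nullary.Decidable using (_×-dec_; _⊎-dec_; ¬?; dec-true; dec-false)
open import Relation.Binary.PropositionalEquality using (refl; cong; cong₂; subst; subst₂; _≢_; module ≡-Reasoning)
import Relation.Binary.PropositionalEquality as ≡

-- Counting Boolean predicates

toℕ : Bool → ℕ
toℕ true  = 1
toℕ false = 0

toℕ≤1 : ∀ b → toℕ b ≤ 1
toℕ≤1 true  = s≤s z≤n
toℕ≤1 false = z≤n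

toℕ≡0⇒false : ∀ {b} → toℕ b ≡ 0 → b ≡ false
toℕ≡0⇒false {false} _ = refl

toℕ-mono : ∀ a b → (a ≡ true → b ≡ true) → toℕ a ≤ toℕ b
toℕ-mono true  b a⇒b rewrite a⇒b refl = s≤s z≤n
toℕ-mono false b a⇒b = z≤n

toℕ-split : ∀ a b → toℕ a ≡ toℕ (a ∧ b) + toℕ (a ∧ not b)
toℕ-split true  true  = refl
toℕ-split true  false = refl
toℕ-split false b     = refl

count : ∀ {n} → (Fin n → Bool) → ℕ
count {zero}  p = 0
count {suc n} p = toℕ (p fz) + count (p ∘ fs)

countL : ∀ {A : Set} → (A → Bool) → List A → ℕ
countL p []       = 0
countL p (x ∷ xs) = toℕ (p x) + countL p xs

∣tabulate∣≡count : ∀ {n} (p : Fin n → Bool) → ∣ tabulate p ∣ ≡ count p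
∣tabulate∣≡count {zero}  p = refl
∣tabulate∣≡count {suc n} p with p fz
... | true  = cong suc (∣tabulate∣≡count (p ∘ fs))
... | false = ∣tabulate∣≡count (p ∘ fs)

countL-tabulate : ∀ {A : Set} {n} (p : A → Bool) (f : Fin n → A) →
                  countL p (L.tabulate f) ≡ count (p ∘ f)
countL-tabulate {n = zero}  p f = refl
countL-tabulate {n = suc n} p f = cong (toℕ (p (f fz)) +_) (countL-tabulate p (f ∘ fs))

count≡countL-allFin : ∀ {n} (p : Fin n → Bool) → count p ≡ countL p (allFin n)
count≡countL-allFin p = ≡.sym (countL-tabulate p id)

count-cong : ∀ {n} (p q : Fin n → Bool) → (∀ x → p x ≡ q x) → count p ≡ count q
count-cong {zero}  p q p≗q = refl
count-cong {suc n} p q p≗q = cong₂ _+_ (cong toℕ (p≗q fz)) (count-cong _ _ (p≗q ∘ fs))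

count-mono : ∀ {n} (p q : Fin n → Bool) → (∀ x → p x ≡ true → q x ≡ true) → count p ≤ count q
count-mono {zero}  p q p⊆q = z≤n
count-mono {suc n} p q p⊆q = +-mono-≤ (toℕ-mono _ _ (p⊆q fz)) (count-mono _ _ (p⊆q ∘ fs))

count-split : ∀ {n} (p q : Fin n → Bool) →
              count p ≡ count (λ x → p x ∧ q x) + count (λ x → p x ∧ not (q x))
count-split {zero}  p q = refl
count-split {suc n} p q
  rewrite toℕ-split (p fz) (q fz) | count-split (p ∘ fs) (q ∘ fs)
  = interchange (toℕ (p fz ∧ q fz)) (toℕ (p fz ∧ not (q fz))) _ _

count-true : ∀ {n} → count {n} (λ _ → true) ≡ n
count-true {zero}  = refl
count-true {suc n} = cong suc (count-true {n})

count-false : ∀ {n} → count {n} (λ _ → false) ≡ 0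
count-false {zero}  = refl
count-false {suc n} = count-false {n}

count-complement : ∀ {n} (p : Fin n → Bool) → count p + count (not ∘ p) ≡ n
count-complement {n} p = ≡.trans (≡.sym (count-split (λ _ → true) p)) (count-true {n})

count-pos⇒∃ : ∀ {n} (p : Fin n → Bool) → 1 ≤ count p → ∃[ x ] (p x ≡ true)
count-pos⇒∃ {suc n} p pos with p fz in eq
... | true  = fz , eq
... | false = let (x , px) = count-pos⇒∃ (p ∘ fs) pos in fs x , px

count≥2⇒∃-distinct : ∀ {n} (p : Fin n → Bool) → 2 ≤ count p →
                     ∃[ x ] ∃[ y ] (x ≢ y × p x ≡ true × p y ≡ true)
count≥2⇒∃-distinct {suc n} p two with p fz in eq
... | true  = let (y , py) = count-pos⇒∃ (p ∘ fs) (s≤s⁻¹ two) in fz , fs y , (λ ()) , eq , py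
... | false = let (x , y , x≢y , px , py) = count≥2⇒∃-distinct (p ∘ fs) two
              in fs x , fs y , x≢y ∘ Fin.suc-injective , px , py

⊆∧count≥⇒⊇ : ∀ {n} (p q : Fin n → Bool) → (∀ x → p x ≡ true → q x ≡ true) →
             count q ≤ count p → ∀ x → q x ≡ true → p x ≡ true
⊆∧count≥⇒⊇ {suc n} p q p⊆q q≤p x qx = go x qx
  where
  head≤ : toℕ (p fz) ≤ toℕ (q fz)
  head≤ = toℕ-mono _ _ (p⊆q fz)
  tail≤ : count (p ∘ fs) ≤ count (q ∘ fs)
  tail≤ = count-mono _ _ (p⊆q ∘ fs)
  head≥ : toℕ (q fz) ≤ toℕ (p fz)
  head≥ = +-cancelʳ-≤ _ _ _ (≤-trans q≤p (+-monoʳ-≤ (toℕ (p fz)) tail≤))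
  tail≥ : count (q ∘ fs) ≤ count (p ∘ fs)
  tail≥ = +-cancelˡ-≤ _ _ _ (≤-trans q≤p (+-monoˡ-≤ (count (p ∘ fs)) head≤))
  go : ∀ x → q x ≡ true → p x ≡ true
  go fz     qx = head-⊇ (p fz) (q fz) (p⊆q fz) head≥ qx
    where
    head-⊇ : ∀ a b → (a ≡ true → b ≡ true) → toℕ b ≤ toℕ a → b ≡ true → a ≡ true
    head-⊇ true  b     _ _  _ = refl
    head-⊇ false true  _ () _
  go (fs x) qx = ⊆∧count≥⇒⊇ (p ∘ fs) (q ∘ fs) (p⊆q ∘ fs) tail≥ x qx

_==_ : ∀ {n} → Fin n → Fin n → Bool
x == y = does (x ≟F y)

==-refl : ∀ {n} (x : Fin n) → (x == x) ≡ true
==-refl x = dec-true (x ≟F x) refl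

==⇒≡ : ∀ {n} {x y : Fin n} → (x == y) ≡ true → x ≡ y
==⇒≡ {x = x} {y} eq with x ≟F y
... | yes x≡y = x≡y
==⇒≡ () | no _

≢⇒==-false : ∀ {n} {x y : Fin n} → x ≢ y → (x == y) ≡ false
≢⇒==-false {x = x} {y} x≢y = dec-false (x ≟F y) x≢y

count-singleton : ∀ {n} (a : Fin n) → count (_== a) ≡ 1
count-singleton {suc n} fz =
  cong suc (≡.trans (count-cong {n} (λ x → fs x == fz) (λ _ → false) (λ x → ≢⇒==-false {x = fs x} {y = fz} λ ()))
                    (count-false {n}))
count-singleton {suc n} (fs a) =
  ≡.trans (cong (_+ count (λ x → fs x == fs a)) (cong toℕ (≢⇒==-false {x = fz} {y = fs a} λ ())))
          (≡.trans (count-cong _ _ fs==fs) (count-singleton a))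
  where
  fs==fs : ∀ x → (fs x == fs a) ≡ (x == a)
  fs==fs x with x ≟F a
  ... | yes refl = refl
  ... | no _     = refl

countL-++ : ∀ {A : Set} (p : A → Bool) xs ys → countL p (xs ++ ys) ≡ countL p xs + countL p ys
countL-++ p []       ys = refl
countL-++ p (x ∷ xs) ys = ≡.trans (cong (toℕ (p x) +_) (countL-++ p xs ys)) (≡.sym (+-assoc (toℕ (p x)) _ _))

countL-middle : ∀ {A : Set} (p : A → Bool) {x} pre post → p x ≡ true →
                countL p (pre ++ x ∷ post) ≡ 1 + countL p (pre ++ post)
countL-middle p {x} pre post px = begin
  countL p (pre ++ x ∷ post)                  ≡⟨ countL-++ p pre (x ∷ post) ⟩
  countL p pre + (toℕ (p x) + countL p post)  ≡⟨ cong (λ b → countL p pre + (toℕ b + countL p post)) px ⟩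
  countL p pre + (1 + countL p post)          ≡⟨ +-suc (countL p pre) (countL p post) ⟩
  1 + (countL p pre + countL p post)          ≡⟨ cong suc (≡.sym (countL-++ p pre post)) ⟩
  1 + countL p (pre ++ post)                  ∎
  where open ≡-Reasoning

∈-++-delete : ∀ {A : Set} {x y : A} (pre post : List A) → y ∈ pre ++ x ∷ post → y ≢ x → y ∈ pre ++ post
∈-++-delete []        post (here y≡x) y≢x = ⊥-elim (y≢x y≡x)
∈-++-delete []        post (there y∈) y≢x = y∈
∈-++-delete (z ∷ pre) post (here y≡z) y≢x = here y≡z
∈-++-delete (z ∷ pre) post (there y∈) y≢x = there (∈-++-delete pre post y∈ y≢x)

countL-mono-⊆ : ∀ {A : Set} (p : A → Bool) (xs ys : List A) → Unique xs →
                (∀ {x} → x ∈ xs → p x ≡ true → x ∈ ys) → countL p xs ≤ countL p ys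
countL-mono-⊆ p []       ys u         xs⊆ys = z≤n
countL-mono-⊆ p (x ∷ xs) ys (x∉ ∷ u) xs⊆ys with p x in px
... | false = countL-mono-⊆ p xs ys u (xs⊆ys ∘ there)
... | true with MP.∈-∃++ (xs⊆ys (here refl) px)
... | pre , post , refl =
  subst (1 + countL p xs ≤_) (≡.sym (countL-middle p pre post px))
        (s≤s (countL-mono-⊆ p xs (pre ++ post) u
                (λ y∈ py → ∈-++-delete pre post (xs⊆ys (there y∈) py) (All.lookup x∉ y∈ ∘ ≡.sym))))

countL≤length : ∀ {A : Set} (p : A → Bool) (xs : List A) → countL p xs ≤ length xs
countL≤length p []       = z≤n
countL≤length p (x ∷ xs) = +-mono-≤ (toℕ≤1 (p x)) (countL≤length p xs)

countL-all : ∀ {A : Set} (p : A → Bool) (xs : List A) → All (λ x → p x ≡ true) xs → countL p xs ≡ length xs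
countL-all p []       []         = refl
countL-all p (x ∷ xs) (px ∷ pxs) rewrite px = cong suc (countL-all p xs pxs)

countL-mono : ∀ {A : Set} (p q : A → Bool) xs → (∀ x → p x ≡ true → q x ≡ true) → countL p xs ≤ countL q xs
countL-mono p q []       p⊆q = z≤n
countL-mono p q (x ∷ xs) p⊆q = +-mono-≤ (toℕ-mono _ _ (p⊆q x)) (countL-mono p q xs p⊆q)

unique⇒countL≤count : ∀ {n} (p : Fin n → Bool) (xs : List (Fin n)) → Unique xs → countL p xs ≤ count p
unique⇒countL≤count {n} p xs u =
  subst (countL p xs ≤_) (≡.sym (count≡countL-allFin p))
        (countL-mono-⊆ p xs (allFin n) u (λ {x} _ _ → MP.∈-allFin x))

⊆⇒count≤countL : ∀ {n} (p : Fin n → Bool) (xs : List (Fin n)) → (∀ x → p x ≡ true → x ∈ xs) → count p ≤ countL p xs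
⊆⇒count≤countL {n} p xs p⊆xs =
  subst (_≤ countL p xs) (≡.sym (count≡countL-allFin p))
        (countL-mono-⊆ p (allFin n) xs (UP.allFin⁺ n) (λ {x} _ px → p⊆xs x px))

∈ₛ⇒lookup : ∀ {n} (S : Subset n) {w} → w ∈ₛ S → lookup S w ≡ true
∈ₛ⇒lookup S w∈S = Vec.[]=⇒lookup w∈S

lookup⇒∈ₛ : ∀ {n} (S : Subset n) {w} → lookup S w ≡ true → w ∈ₛ S
lookup⇒∈ₛ S {w} Sw = Vec.lookup⇒[]= w S Sw

∈-tabulate : ∀ {n} (p : Fin n → Bool) {w} → w ∈ₛ tabulate p → p w ≡ true
∈-tabulate p {w} w∈ = ≡.trans (≡.sym (Vec.lookup∘tabulate p w)) (∈ₛ⇒lookup (tabulate p) w∈)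

tabulate-∈ : ∀ {n} (p : Fin n → Bool) {w} → p w ≡ true → w ∈ₛ tabulate p
tabulate-∈ p {w} pw = lookup⇒∈ₛ (tabulate p) (≡.trans (Vec.lookup∘tabulate p w) pw)

∣∣≡count-lookup : ∀ {n} (S : Subset n) → ∣ S ∣ ≡ count (lookup S)
∣∣≡count-lookup S = ≡.trans (cong ∣_∣ (≡.sym (Vec.tabulate∘lookup S))) (∣tabulate∣≡count (lookup S))

2*-double : ∀ j → 2 * j ≡ j + j
2*-double j = cong (j +_) (+-identityʳ j)

count-pair : ∀ {n} (u v : Fin n) → u ≢ v → count (λ w → (w == u) ∨ (w == v)) ≡ 2
count-pair u v u≢v = ≡.trans (count-split _ (_== u))
  (cong₂ _+_ (≡.trans (count-cong _ _ on-u) (count-singleton u)) (≡.trans (count-cong _ _ off-u) (count-singleton v)))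
  where
  on-u : ∀ w → ((w == u) ∨ (w == v)) ∧ (w == u) ≡ (w == u)
  on-u w with w ≟F u
  ... | yes _ = refl
  ... | no _  = ∧-zeroʳ _
  off-u : ∀ w → ((w == u) ∨ (w == v)) ∧ not (w == u) ≡ (w == v)
  off-u w with w ≟F u | w ≟F v
  ... | yes refl | yes u≡v = ⊥-elim (u≢v u≡v)
  ... | yes refl | no _    = refl
  ... | no _     | yes _   = refl
  ... | no _     | no _    = refl

-- Matchings and augmenting paths

Unique-resp-↭ : ∀ {A : Set} {xs ys : List A} → xs ↭ ys → Unique xs → Unique ys
Unique-resp-↭ {A} xs↭ys = ↭ₛ.Unique-resp-↭ (≡.setoid A) (↭⇒↭ₛ xs↭ys)

≡true⇒≢false : ∀ {b : Bool} → b ≡ true → b ≢ false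
≡true⇒≢false refl ()

∧-trueˡ : ∀ {a b} → a ∧ b ≡ true → a ≡ true
∧-trueˡ {true} _ = refl

∧-trueʳ : ∀ {a b} → a ∧ b ≡ true → b ≡ true
∧-trueʳ {true} ab = ab

∧-intro : ∀ {a b} → a ≡ true → b ≡ true → a ∧ b ≡ true
∧-intro refl refl = refl

∨-true : ∀ {a b} → a ∨ b ≡ true → a ≡ true ⊎ b ≡ true
∨-true {true}  _  = inj₁ refl
∨-true {false} ab = inj₂ ab

∨-false : ∀ {a b} → a ∨ b ≡ false → a ≡ false × b ≡ false
∨-false {false} ab = refl , ab

not-true⇒false : ∀ {b} → not b ≡ true → b ≡ false
not-true⇒false {false} _ = refl

false⇒not-true : ∀ {b} → b ≡ false → not b ≡ true
false⇒not-true refl = refl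

Pair : ℕ → Set
Pair n = Fin n × Fin n

module Matchings {n : ℕ} (G : Graph n) where
  open DecMembership (_≟F_ {n}) using (_∈?_)
  open DecMembership (Product.≡-dec (_≟F_ {n}) (_≟F_ {n})) using () renaming (_∈?_ to _∈E?_)

  AllEdges : List (Pair n) → Set
  AllEdges M = All (λ e → Edge G (proj₁ e) (proj₂ e)) M

  V : List (Pair n) → List (Fin n)
  V = verts G

  V-++ : ∀ (xs ys : List (Pair n)) → V (xs ++ ys) ≡ V xs ++ V ys
  V-++ []             ys = refl
  V-++ ((a , b) ∷ xs) ys = cong (λ zs → a ∷ b ∷ zs) (V-++ xs ys)

  V-↭ : ∀ {xs ys : List (Pair n)} → xs ↭ ys → V xs ↭ V ys
  V-↭ ↭-refl                    = ↭-refl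
  V-↭ (prep (a , b) p)          = prep a (prep b (V-↭ p))
  V-↭ (swap (a , b) (c , d) p) =
    ↭-trans (PP.++⁺ˡ (a ∷ b ∷ []) (prep c (prep d (V-↭ p)))) (PP.shifts (a ∷ b ∷ []) (c ∷ d ∷ []))
  V-↭ (↭-trans p q)             = ↭-trans (V-↭ p) (V-↭ q)

  length-V : ∀ (M : List (Pair n)) → length (V M) ≡ 2 * length M
  length-V []            = refl
  length-V ((a , b) ∷ M) = ≡.trans (cong (2 +_) (length-V M)) (≡.sym (*-suc 2 (length M)))

  _∈ᵒ_ : Pair n → List (Pair n) → Set
  (a , b) ∈ᵒ M = (a , b) ∈ M ⊎ (b , a) ∈ M

  ∈ᵒ-flip : ∀ {a b M} → (a , b) ∈ᵒ M → (b , a) ∈ᵒ M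
  ∈ᵒ-flip (inj₁ ab) = inj₂ ab
  ∈ᵒ-flip (inj₂ ba) = inj₁ ba

  ∈⇒∈V₁ : ∀ {a b M} → (a , b) ∈ M → a ∈ V M
  ∈⇒∈V₁ {M = _ ∷ M} (here refl) = here refl
  ∈⇒∈V₁ {M = _ ∷ M} (there ab)  = there (there (∈⇒∈V₁ ab))

  ∈⇒∈V₂ : ∀ {a b M} → (a , b) ∈ M → b ∈ V M
  ∈⇒∈V₂ {M = _ ∷ M} (here refl) = there (here refl)
  ∈⇒∈V₂ {M = _ ∷ M} (there ab)  = there (there (∈⇒∈V₂ ab))

  ∈ᵒ⇒∈V₁ : ∀ {a b M} → (a , b) ∈ᵒ M → a ∈ V M
  ∈ᵒ⇒∈V₁ (inj₁ ab) = ∈⇒∈V₁ ab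
  ∈ᵒ⇒∈V₁ (inj₂ ba) = ∈⇒∈V₂ ba

  ∈V⇒partner : ∀ {w} M → w ∈ V M → ∃[ a ] ((a , w) ∈ᵒ M)
  ∈V⇒partner ((x , y) ∷ M) (here refl)         = y , inj₂ (here refl)
  ∈V⇒partner ((x , y) ∷ M) (there (here refl)) = x , inj₁ (here refl)
  ∈V⇒partner ((x , y) ∷ M) (there (there w∈)) with ∈V⇒partner M w∈
  ... | a , inj₁ aw = a , inj₁ (there aw)
  ... | a , inj₂ wa = a , inj₂ (there wa)

  partner-unique : ∀ {a b c} M → Unique (V M) → (a , b) ∈ᵒ M → (a , c) ∈ᵒ M → b ≡ c
  partner-unique (_ ∷ M) _                (inj₁ (here refl)) (inj₁ (here refl)) = refl
  partner-unique (_ ∷ M) _                (inj₂ (here refl)) (inj₂ (here refl)) = refl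
  partner-unique (_ ∷ M) ((x≢y ∷ _) ∷ _)  (inj₁ (here refl)) (inj₂ (here refl)) = ⊥-elim (x≢y refl)
  partner-unique (_ ∷ M) ((x≢y ∷ _) ∷ _)  (inj₂ (here refl)) (inj₁ (here refl)) = ⊥-elim (x≢y refl)
  partner-unique (_ ∷ M) ((_ ∷ x∉) ∷ _)   (inj₁ (here refl)) (inj₁ (there ac)) = ⊥-elim (All.lookup x∉ (∈⇒∈V₁ ac) refl)
  partner-unique (_ ∷ M) ((_ ∷ x∉) ∷ _)   (inj₁ (here refl)) (inj₂ (there ca)) = ⊥-elim (All.lookup x∉ (∈⇒∈V₂ ca) refl)
  partner-unique (_ ∷ M) (_ ∷ (y∉ ∷ _))   (inj₂ (here refl)) (inj₁ (there ac)) = ⊥-elim (All.lookup y∉ (∈⇒∈V₁ ac) refl)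
  partner-unique (_ ∷ M) (_ ∷ (y∉ ∷ _))   (inj₂ (here refl)) (inj₂ (there ca)) = ⊥-elim (All.lookup y∉ (∈⇒∈V₂ ca) refl)
  partner-unique (_ ∷ M) ((_ ∷ x∉) ∷ _)   (inj₁ (there ab)) (inj₁ (here refl)) = ⊥-elim (All.lookup x∉ (∈⇒∈V₁ ab) refl)
  partner-unique (_ ∷ M) ((_ ∷ x∉) ∷ _)   (inj₂ (there ba)) (inj₁ (here refl)) = ⊥-elim (All.lookup x∉ (∈⇒∈V₂ ba) refl)
  partner-unique (_ ∷ M) (_ ∷ (y∉ ∷ _))   (inj₁ (there ab)) (inj₂ (here refl)) = ⊥-elim (All.lookup y∉ (∈⇒∈V₁ ab) refl)
  partner-unique (_ ∷ M) (_ ∷ (y∉ ∷ _))   (inj₂ (there ba)) (inj₂ (here refl)) = ⊥-elim (All.lookup y∉ (∈⇒∈V₂ ba) refl)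
  partner-unique (_ ∷ M) (_ ∷ (_ ∷ u))    (inj₁ (there ab)) (inj₁ (there ac)) = partner-unique M u (inj₁ ab) (inj₁ ac)
  partner-unique (_ ∷ M) (_ ∷ (_ ∷ u))    (inj₁ (there ab)) (inj₂ (there ca)) = partner-unique M u (inj₁ ab) (inj₂ ca)
  partner-unique (_ ∷ M) (_ ∷ (_ ∷ u))    (inj₂ (there ba)) (inj₁ (there ac)) = partner-unique M u (inj₂ ba) (inj₁ ac)
  partner-unique (_ ∷ M) (_ ∷ (_ ∷ u))    (inj₂ (there ba)) (inj₂ (there ca)) = partner-unique M u (inj₂ ba) (inj₂ ca)

  remove : ∀ {e} M → e ∈ M → Σ (List (Pair n)) λ rest → M ↭ e ∷ rest
  remove M e∈ with MP.∈-∃++ e∈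
  ... | pre , post , refl = pre ++ post , PP.shift _ pre post

  AllEdges-↭-∷ : ∀ {M : List (Pair n)} {e rest} → M ↭ e ∷ rest → AllEdges M → AllEdges rest
  AllEdges-↭-∷ p es with PP.All-resp-↭ p es
  ... | _ ∷ rest-edges = rest-edges

  ∈-↭-∷-≢ : ∀ {M : List (Pair n)} {e rest x} → M ↭ e ∷ rest → x ∈ M → x ≢ e → x ∈ rest
  ∈-↭-∷-≢ p x∈ x≢e with PP.∈-resp-↭ p x∈
  ... | here x≡e = ⊥-elim (x≢e x≡e)
  ... | there x∈rest = x∈rest

  record Removal (M : List (Pair n)) (a b : Fin n) : Set where
    field
      rest        : List (Pair n)
      V-↭-rest    : V M ↭ a ∷ b ∷ V rest
      rest-edges  : AllEdges M → AllEdges rest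
      keeps-other : ∀ {c d} → (c , d) ∈ M → c ≢ a → c ≢ b → (c , d) ∈ rest

  removeᵒ : ∀ {a b} M → (a , b) ∈ᵒ M → Removal M a b
  removeᵒ M (inj₁ ab) with remove M ab
  ... | rest , p = record
    { rest = rest ; V-↭-rest = V-↭ p ; rest-edges = AllEdges-↭-∷ p
    ; keeps-other = λ cd c≢a _ → ∈-↭-∷-≢ p cd (c≢a ∘ cong proj₁) }
  removeᵒ M (inj₂ ba) with remove M ba
  ... | rest , p = record
    { rest = rest ; V-↭-rest = ↭-trans (V-↭ p) (swap _ _ ↭-refl) ; rest-edges = AllEdges-↭-∷ p
    ; keeps-other = λ cd _ c≢b → ∈-↭-∷-≢ p cd (c≢b ∘ cong proj₁) }

  ∈ᵒ-rest : ∀ {M a b c d} (r : Removal M a b) → (c , d) ∈ᵒ M →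
            c ≢ a → c ≢ b → d ≢ a → d ≢ b → (c , d) ∈ᵒ Removal.rest r
  ∈ᵒ-rest r (inj₁ cd) c≢a c≢b _   _   = inj₁ (Removal.keeps-other r cd c≢a c≢b)
  ∈ᵒ-rest r (inj₂ dc) _   _   d≢a d≢b = inj₂ (Removal.keeps-other r dc d≢a d≢b)

  -- Replacing the edges of M covering R by new edges covering F ++ R.
  augment : ∀ (M rest new : List (Pair n)) (R F : List (Fin n)) → IsMatching G M → AllEdges rest →
            V M ↭ R ++ V rest → AllEdges new → V new ↭ F ++ R → Unique F → All (_∉ V M) F →
            IsMatching G (new ++ rest) × (V (new ++ rest) ↭ F ++ V M)
  augment M rest new R F (M-edges , M-unique) rest-edges M↭ new-edges new↭ F-unique F∉M =
    (AllP.++⁺ new-edges rest-edges , Unique-resp-↭ (↭-sym V↭) (UP.++⁺ F-unique M-unique F∩M=∅)) , V↭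
    where
    V↭ : V (new ++ rest) ↭ F ++ V M
    V↭ = subst (_↭ F ++ V M) (≡.sym (V-++ new rest))
           (↭-trans (PP.++⁺ʳ (V rest) new↭)
           (↭-trans (↭-reflexive (Lₚ.++-assoc F R (V rest)))
                    (PP.++⁺ˡ F (↭-sym M↭))))
    F∩M=∅ : ∀ {v} → v ∈ F × v ∈ V M → ⊥
    F∩M=∅ (v∈F , v∈M) = All.lookup F∉M v∈F v∈M

  length-augment : ∀ (M M′ : List (Pair n)) (F : List (Fin n)) → V M′ ↭ F ++ V M → length F ≡ 2 →
                   length M′ ≡ suc (length M)
  length-augment M M′ F M′↭ F-size = *-cancelˡ-≡ (length M′) (suc (length M)) 2 (begin
    2 * length M′          ≡⟨ ≡.sym (length-V M′) ⟩
    length (V M′)          ≡⟨ PP.↭-length M′↭ ⟩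
    length (F ++ V M)      ≡⟨ Lₚ.length-++ F ⟩
    length F + length (V M) ≡⟨ cong₂ _+_ F-size (length-V M) ⟩
    2 + 2 * length M       ≡⟨ ≡.sym (*-suc 2 (length M)) ⟩
    2 * suc (length M)     ∎)
    where open ≡-Reasoning

  adj′ : Fin n → Fin n → Bool
  adj′ = adj G

  adj-sym : ∀ x y → adj′ x y ≡ adj′ y x
  adj-sym = Graph.sym G

  adj-irrefl : ∀ x → adj′ x x ≡ false
  adj-irrefl = Graph.irrefl G

  adj⇒≢ : ∀ {x y} → adj′ x y ≡ true → x ≢ y
  adj⇒≢ {x} xy refl = ≡true⇒≢false xy (adj-irrefl x)

  ≟true : ∀ (b : Bool) → Dec (b ≡ true)
  ≟true b = b ≟B true

  inV : List (Pair n) → Fin n → Bool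
  inV M w = does (w ∈? V M)

  inV⇒∈ : ∀ M {w} → inV M w ≡ true → w ∈ V M
  inV⇒∈ M {w} _ with w ∈? V M
  ... | yes w∈ = w∈

  ∈⇒inV : ∀ M {w} → w ∈ V M → inV M w ≡ true
  ∈⇒inV M {w} w∈ = dec-true (w ∈? V M) w∈

  inV-false⇒∉ : ∀ M {w} → inV M w ≡ false → w ∉ V M
  inV-false⇒∉ M w∉ w∈ = ≡true⇒≢false (∈⇒inV M w∈) w∉

  ∈ᵒ-dec : ∀ a b M → Dec ((a , b) ∈ᵒ M)
  ∈ᵒ-dec a b M = ((a , b) ∈E? M) ⊎-dec ((b , a) ∈E? M)

  path3? : ∀ M u v → Dec (∃[ a ] ∃[ b ] ((a , b) ∈ᵒ M × adj′ u a ≡ true × adj′ b v ≡ true))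
  path3? M u v = any? λ a → any? λ b → ∈ᵒ-dec a b M ×-dec (≟true (adj′ u a) ×-dec ≟true (adj′ b v))

  path5? : ∀ M u v → Dec (∃[ a ] ∃[ b ] ∃[ c ] ∃[ d ] ((a , b) ∈ᵒ M × (c , d) ∈ᵒ M × c ≢ a × c ≢ b ×
                                                       adj′ u a ≡ true × adj′ b c ≡ true × adj′ d v ≡ true))
  path5? M u v = any? λ a → any? λ b → any? λ c → any? λ d →
    ∈ᵒ-dec a b M ×-dec (∈ᵒ-dec c d M ×-dec (¬? (c ≟F a) ×-dec (¬? (c ≟F b) ×-dec
      (≟true (adj′ u a) ×-dec (≟true (adj′ b c) ×-dec ≟true (adj′ d v))))))

  free : (Fin n → Bool) → List (Pair n) → Fin n → Bool
  free H M w = H w ∧ not (inV M w)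

record RegionMatching {n : ℕ} (G : Graph n) (H : Fin n → Bool) (j : ℕ) : Set where
  constructor regionMatching
  field
    edges      : List (Pair n)
    isMatching : IsMatching G edges
    inRegion   : All (λ w → H w ≡ true) (verts G edges)
    size       : length edges ≡ j

open RegionMatching using (edges)

module Region {n : ℕ} (G : Graph n) (H : Fin n → Bool) where
  open Matchings G

  Free : ∀ {j} → RegionMatching G H j → Fin n → Bool
  Free mm = free H (edges mm)

  free⇒∉V : ∀ M {w} → free H M w ≡ true → w ∉ V M
  free⇒∉V M fw = inV-false⇒∉ M (not-true⇒false (∧-trueʳ fw))

  free⇒inRegion : ∀ M {w} → free H M w ≡ true → H w ≡ true
  free⇒inRegion M {w} fw = ∧-trueˡ {H w} fw

  emptyMatching : RegionMatching G H 0
  emptyMatching = regionMatching [] ([] , []) [] refl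

  -- The edges `new` form an augmenting path from u to v through the ends R of the removed edges.
  augmentAlong : ∀ {j} (mm : RegionMatching G H j) {u v} (R : List (Fin n)) (rest new : List (Pair n)) →
                 Free mm u ≡ true → Free mm v ≡ true → u ≢ v →
                 V (edges mm) ↭ R ++ V rest → AllEdges rest → AllEdges new → V new ↭ u ∷ v ∷ R →
                 RegionMatching G H (suc j)
  augmentAlong (regionMatching M isM inH size) {u} {v} R rest new fu fv u≢v M↭ rest-edges new-edges new↭ =
    regionMatching (new ++ rest) isM′
      (PP.All-resp-↭ (↭-sym V↭) (free⇒inRegion M fu ∷ free⇒inRegion M fv ∷ inH))
      (≡.trans (length-augment M (new ++ rest) (u ∷ v ∷ []) V↭ refl) (cong suc size))
    where
    augmented : IsMatching G (new ++ rest) × (V (new ++ rest) ↭ (u ∷ v ∷ []) ++ V M)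
    augmented = augment M rest new R (u ∷ v ∷ []) isM rest-edges M↭ new-edges new↭
                  ((u≢v ∷ []) ∷ [] ∷ []) (free⇒∉V M fu ∷ free⇒∉V M fv ∷ [])
    isM′ : IsMatching G (new ++ rest)
    isM′ = proj₁ augmented
    V↭ : V (new ++ rest) ↭ u ∷ v ∷ V M
    V↭ = proj₂ augmented

  extendByEdge : ∀ {j} (mm : RegionMatching G H j) {x y} → Free mm x ≡ true → Free mm y ≡ true →
                 adj′ x y ≡ true → RegionMatching G H (suc j)
  extendByEdge mm {x} {y} fx fy xy =
    augmentAlong mm [] (edges mm) ((x , y) ∷ []) fx fy (adj⇒≢ xy) ↭-refl
      (proj₁ (RegionMatching.isMatching mm)) (xy ∷ []) ↭-refl

  augment3 : ∀ {j} (mm : RegionMatching G H j) {u v a b} → Free mm u ≡ true → Free mm v ≡ true → u ≢ v →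
             (a , b) ∈ᵒ edges mm → adj′ u a ≡ true → adj′ b v ≡ true → RegionMatching G H (suc j)
  augment3 mm {u} {v} {a} {b} fu fv u≢v ab ua bv =
    augmentAlong mm (a ∷ b ∷ []) (rest r) ((u , a) ∷ (b , v) ∷ []) fu fv u≢v (Removal.V-↭-rest r)
      (rest-edges r (proj₁ (RegionMatching.isMatching mm))) (ua ∷ bv ∷ [])
      (prep u (PP.shift v (a ∷ b ∷ []) []))
    where
    open Removal
    r : Removal (edges mm) a b
    r = removeᵒ (edges mm) ab

  augment5 : ∀ {j} (mm : RegionMatching G H j) {u v a b c d} → Free mm u ≡ true → Free mm v ≡ true → u ≢ v →
             (a , b) ∈ᵒ edges mm → (c , d) ∈ᵒ edges mm → c ≢ a → c ≢ b →
             adj′ u a ≡ true → adj′ b c ≡ true → adj′ d v ≡ true → RegionMatching G H (suc j)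
  augment5 mm {u} {v} {a} {b} {c} {d} fu fv u≢v ab cd c≢a c≢b ua bc dv =
    augmentAlong mm (a ∷ b ∷ c ∷ d ∷ []) (rest r₂) ((u , a) ∷ (b , c) ∷ (d , v) ∷ []) fu fv u≢v
      (↭-trans (Removal.V-↭-rest r₁) (prep a (prep b (Removal.V-↭-rest r₂))))
      (rest-edges r₂ (rest-edges r₁ (proj₁ (RegionMatching.isMatching mm)))) (ua ∷ bc ∷ dv ∷ [])
      (prep u (PP.shift v (a ∷ b ∷ c ∷ d ∷ []) []))
    where
    open Removal
    M-unique : Unique (V (edges mm))
    M-unique = proj₂ (RegionMatching.isMatching mm)
    d≢a : d ≢ a
    d≢a refl = c≢b (≡.sym (partner-unique (edges mm) M-unique ab (∈ᵒ-flip cd)))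
    d≢b : d ≢ b
    d≢b refl = c≢a (≡.sym (partner-unique (edges mm) M-unique (∈ᵒ-flip ab) (∈ᵒ-flip cd)))
    r₁ : Removal (edges mm) a b
    r₁ = removeᵒ (edges mm) ab
    r₂ : Removal (rest r₁) c d
    r₂ = removeᵒ (rest r₁) (∈ᵒ-rest r₁ cd c≢a c≢b d≢a d≢b)

  count-covered : ∀ {j} (mm : RegionMatching G H j) → count (λ w → H w ∧ inV (edges mm) w) ≡ 2 * j
  count-covered (regionMatching M isM inH size) =
    ≡.trans (≤-antisym covered≤ covered≥) (≡.trans (length-V M) (cong (2 *_) size))
    where
    covered : Fin n → Bool
    covered w = H w ∧ inV M w
    covered≤ : count covered ≤ length (V M)
    covered≤ = ≤-trans (⊆⇒count≤countL covered (V M) (λ x cx → inV⇒∈ M (∧-trueʳ {H x} cx)))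
                       (countL≤length covered (V M))
    covered≥ : length (V M) ≤ count covered
    covered≥ = subst (_≤ count covered)
                 (countL-all covered (V M) (All.tabulate (λ w∈ → ∧-intro (All.lookup inH w∈) (∈⇒inV M w∈))))
                 (unique⇒countL≤count covered (V M) (proj₂ isM))

  count-free : ∀ {j} (mm : RegionMatching G H j) → count (Free mm) + 2 * j ≡ count H
  count-free {j} mm = begin
    count (Free mm) + 2 * j                                   ≡⟨ +-comm (count (Free mm)) (2 * j) ⟩
    2 * j + count (Free mm)                                   ≡⟨ cong (_+ count (Free mm)) (≡.sym (count-covered mm)) ⟩
    count (λ w → H w ∧ inV (edges mm) w) + count (Free mm)    ≡⟨ ≡.sym (count-split H (inV (edges mm))) ⟩
    count H                                                   ∎
    where open ≡-Reasoning

  perfect⇒covers : ∀ {j} (mm : RegionMatching G H j) → count H ≡ 2 * j → ∀ w → H w ≡ true → w ∈ V (edges mm)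
  perfect⇒covers mm H-size w hw =
    inV⇒∈ (edges mm) (∧-trueʳ {H w}
      (⊆∧count≥⇒⊇ (λ w → H w ∧ inV (edges mm) w) H (λ x cx → ∧-trueˡ {H x} cx)
                   (≤-reflexive (≡.trans H-size (≡.sym (count-covered mm)))) w hw))

  freeEdge? : ∀ M → Dec (∃[ x ] ∃[ y ] (free H M x ≡ true × free H M y ≡ true × adj′ x y ≡ true))
  freeEdge? M = any? λ x → any? λ y → ≟true (free H M x) ×-dec (≟true (free H M y) ×-dec ≟true (adj′ x y))

-- Sums over edge lists

sumMap : ∀ {A : Set} → (A → ℕ) → List A → ℕ
sumMap f []       = 0
sumMap f (x ∷ xs) = f x + sumMap f xs

countL-V : ∀ {n} (G : Graph n) (p : Fin n → Bool) (M : List (Pair n)) →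
           countL p (verts G M) ≡ sumMap (λ e → toℕ (p (proj₁ e)) + toℕ (p (proj₂ e))) M
countL-V G p []            = refl
countL-V G p ((a , b) ∷ M) =
  ≡.trans (cong (λ s → toℕ (p a) + (toℕ (p b) + s)) (countL-V G p M)) (≡.sym (+-assoc (toℕ (p a)) (toℕ (p b)) _))

sumMap-+ : ∀ {A : Set} (f g : A → ℕ) xs → sumMap f xs + sumMap g xs ≡ sumMap (λ e → f e + g e) xs
sumMap-+ f g []       = refl
sumMap-+ f g (x ∷ xs) =
  ≡.trans (interchange (f x) (sumMap f xs) (g x) (sumMap g xs)) (cong (f x + g x +_) (sumMap-+ f g xs))

sumMap-suc : ∀ {A : Set} (f : A → ℕ) xs → sumMap (suc ∘ f) xs ≡ length xs + sumMap f xs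
sumMap-suc f []       = refl
sumMap-suc f (x ∷ xs) = cong suc (≡.trans (cong (f x +_) (sumMap-suc f xs)) (x+[y+z]≡y+[x+z] (f x) (length xs) _))
  where
  x+[y+z]≡y+[x+z] : ∀ x y z → x + (y + z) ≡ y + (x + z)
  x+[y+z]≡y+[x+z] = solve-∀

sumMap-mono : ∀ {A : Set} (f g : A → ℕ) xs → (∀ e → e ∈ xs → f e ≤ g e) → sumMap f xs ≤ sumMap g xs
sumMap-mono f g []       f≤g = z≤n
sumMap-mono f g (x ∷ xs) f≤g = +-mono-≤ (f≤g x (here refl)) (sumMap-mono f g xs (λ e → f≤g e ∘ there))

length≤sumMap : ∀ {A : Set} (f : A → ℕ) xs → (∀ e → e ∈ xs → 1 ≤ f e) → length xs ≤ sumMap f xs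
length≤sumMap f []       f≥1 = z≤n
length≤sumMap f (x ∷ xs) f≥1 = +-mono-≤ (f≥1 x (here refl)) (length≤sumMap f xs (λ e → f≥1 e ∘ there))

sumMap≤2*length : ∀ {A : Set} (f : A → ℕ) xs → (∀ e → e ∈ xs → f e ≤ 2) → sumMap f xs ≤ 2 * length xs
sumMap≤2*length f []       f≤2 = z≤n
sumMap≤2*length f (x ∷ xs) f≤2 =
  subst (f x + sumMap f xs ≤_) (≡.sym (*-suc 2 (length xs)))
        (+-mono-≤ (f≤2 x (here refl)) (sumMap≤2*length f xs (λ e → f≤2 e ∘ there)))

sumMap-tight : ∀ {A : Set} (f : A → ℕ) xs → (∀ e → e ∈ xs → f e ≤ 2) → 2 * length xs ≤ sumMap f xs →
               ∀ e → e ∈ xs → f e ≡ 2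
sumMap-tight f (x ∷ xs) f≤2 tight = go
  where
  tail≤ : sumMap f xs ≤ 2 * length xs
  tail≤ = sumMap≤2*length f xs (λ e → f≤2 e ∘ there)
  tight′ : 2 + 2 * length xs ≤ f x + sumMap f xs
  tight′ = subst (_≤ f x + sumMap f xs) (*-suc 2 (length xs)) tight
  go : ∀ e → e ∈ x ∷ xs → f e ≡ 2
  go e (here refl) = ≤-antisym (f≤2 x (here refl))
                       (+-cancelʳ-≤ (2 * length xs) 2 (f x) (≤-trans tight′ (+-monoʳ-≤ (f x) tail≤)))
  go e (there e∈)  = sumMap-tight f xs (λ e → f≤2 e ∘ there)
                       (+-cancelˡ-≤ 2 _ _ (≤-trans tight′ (+-monoˡ-≤ (sumMap f xs) (f≤2 x (here refl))))) e e∈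

sumMap≤0⇒≡0 : ∀ {A : Set} (f : A → ℕ) xs → sumMap f xs ≤ 0 → ∀ e → e ∈ xs → f e ≡ 0
sumMap≤0⇒≡0 f (x ∷ xs) ≤0 e (here refl) = n≤0⇒n≡0 (≤-trans (m≤m+n (f x) _) ≤0)
sumMap≤0⇒≡0 f (x ∷ xs) ≤0 e (there e∈)  = sumMap≤0⇒≡0 f xs (≤-trans (m≤n+m _ (f x)) ≤0) e e∈

sumMap-even : ∀ {A : Set} (f : A → ℕ) xs → (∀ e → e ∈ xs → f e ≡ 0 ⊎ f e ≡ 2) → ∃[ t ] (sumMap f xs ≡ 2 * t)
sumMap-even f []       f∈02 = 0 , refl
sumMap-even f (x ∷ xs) f∈02 with sumMap-even f xs (λ e → f∈02 e ∘ there) | f∈02 x (here refl)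
... | t , s≡2t | inj₁ fx≡0 = t     , cong₂ _+_ fx≡0 s≡2t
... | t , s≡2t | inj₂ fx≡2 = suc t , ≡.trans (cong₂ _+_ fx≡2 s≡2t) (≡.sym (*-suc 2 t))

-- Recognising the excluded join

module JoinOfTwoCliques {n : ℕ} (G : Graph n) where
  open Matchings G

  pattern 0F = fz
  pattern 1F = fs fz
  pattern 2F = fs (fs fz)

  part : Bool → Bool → Fin 3
  part true  _     = 1F
  part false true  = 2F
  part false false = 0F

  part≟0 : ∀ a b → does (part a b ≟F 0F) ≡ not a ∧ not b
  part≟0 true  _     = refl
  part≟0 false true  = refl
  part≟0 false false = refl

  part≟1 : ∀ a b → does (part a b ≟F 1F) ≡ a
  part≟1 true  _     = refl
  part≟1 false true  = refl
  part≟1 false false = refl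

  part≟2 : ∀ a b → (a ≡ true → b ≡ false) → does (part a b ≟F 2F) ≡ b
  part≟2 true  _     a⇒¬b rewrite a⇒¬b refl = refl
  part≟2 false true  _ = refl
  part≟2 false false _ = refl

  part≡1⇒ : ∀ {a b} → part a b ≡ 1F → a ≡ true
  part≡1⇒ {true} _ = refl
  part≡1⇒ {false} {true} ()
  part≡1⇒ {false} {false} ()

  part≡2⇒ : ∀ {a b} → part a b ≡ 2F → b ≡ true
  part≡2⇒ {true} ()
  part≡2⇒ {false} {true} _ = refl
  part≡2⇒ {false} {false} ()

  part≡0⇒ : ∀ {a b} → part a b ≡ 0F → a ≡ false × b ≡ false
  part≡0⇒ {true} ()
  part≡0⇒ {false} {true} ()
  part≡0⇒ {false} {false} _ = refl , refl

  part≢0⇒ : ∀ {a b} → part a b ≢ 0F → a ∨ b ≡ true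
  part≢0⇒ {true} _ = refl
  part≢0⇒ {false} {true} _ = refl
  part≢0⇒ {false} {false} ≢0 = ⊥-elim (≢0 refl)

  isJoinOfTwoCliques-intro : (g₁ g₂ : Fin n → Bool) (a r : ℕ) →
    (∀ x → g₁ x ≡ true → g₂ x ≡ false) →
    count (λ x → not (g₁ x) ∧ not (g₂ x)) ≡ a → count g₁ ≡ r → count g₂ ≡ r →
    (∀ x y → x ≢ y → g₁ x ≡ true → g₁ y ≡ true → adj′ x y ≡ true) →
    (∀ x y → x ≢ y → g₂ x ≡ true → g₂ y ≡ true → adj′ x y ≡ true) →
    (∀ x y → g₁ x ≡ true → g₂ y ≡ true → adj′ x y ≡ false) →
    (∀ x y → g₁ x ≡ false → g₂ x ≡ false → g₁ y ∨ g₂ y ≡ true → adj′ x y ≡ true) →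
    IsJoinOfTwoCliques G a r
  isJoinOfTwoCliques-intro g₁ g₂ a r disjoint size₀ size₁ size₂ clique₁ clique₂ apart joined =
    f , size-of 0F (λ x → part≟0 (g₁ x) (g₂ x)) size₀
      , size-of 1F (λ x → part≟1 (g₁ x) (g₂ x)) size₁
      , size-of 2F (λ x → part≟2 (g₁ x) (g₂ x) (disjoint x)) size₂
      , cliques , (λ x y fx fy → apart x y (part≡1⇒ fx) (part≡2⇒ fy))
      , (λ x y fx fy → let (g₁x , g₂x) = part≡0⇒ fx in joined x y g₁x g₂x (part≢0⇒ fy))
    where
    f : Fin n → Fin 3
    f x = part (g₁ x) (g₂ x)
    size-of : ∀ {s} i {g : Fin n → Bool} → (∀ x → does (f x ≟F i) ≡ g x) → count g ≡ s →
              ∣ tabulate (λ x → does (f x ≟F i)) ∣ ≡ s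
    size-of i {g} f≗g g-size = ≡.trans (∣tabulate∣≡count {n} _) (≡.trans (count-cong {n} _ g f≗g) g-size)
    cliques : ∀ x y → x ≢ y → f x ≡ f y → f x ≢ 0F → Edge G x y
    cliques x y x≢y fx≡fy fx≢0 with f x in fx
    ... | 0F = ⊥-elim (fx≢0 refl)
    ... | 1F = clique₁ x y x≢y (part≡1⇒ fx) (part≡1⇒ (≡.sym fx≡fy))
    ... | 2F = clique₂ x y x≢y (part≡2⇒ fx) (part≡2⇒ (≡.sym fx≡fy))

-- Graphs in which every vertex has at most m + 1 non-neighbours

links : Bool → Bool → Bool → Bool → ℕ
links ua ub va vb = (toℕ ua + toℕ ub) + (toℕ va + toℕ vb)

links-swap : ∀ ua ub va vb → links ua ub va vb ≡ links ub ua vb va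
links-swap ua ub va vb = cong₂ _+_ (+-comm (toℕ ua) (toℕ ub)) (+-comm (toℕ va) (toℕ vb))

data LinkPattern (ua ub va vb : Bool) : Set where
  both-u : ua ≡ true  → ub ≡ true  → va ≡ false → vb ≡ false → LinkPattern ua ub va vb
  both-v : ua ≡ false → ub ≡ false → va ≡ true  → vb ≡ true  → LinkPattern ua ub va vb
  via-a  : ua ≡ true  → ub ≡ false → va ≡ true  → vb ≡ false → LinkPattern ua ub va vb
  via-b  : ua ≡ false → ub ≡ true  → va ≡ false → vb ≡ true  → LinkPattern ua ub va vb

links≤2 : ∀ ua ub va vb → (ua ≡ true → vb ≡ true → ⊥) → (ub ≡ true → va ≡ true → ⊥) → links ua ub va vb ≤ 2
links≤2 true  true  true  true  no-ab no-ba = ⊥-elim (no-ab refl refl)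
links≤2 true  true  true  false no-ab no-ba = ⊥-elim (no-ba refl refl)
links≤2 true  true  false true  no-ab no-ba = ⊥-elim (no-ab refl refl)
links≤2 true  true  false false no-ab no-ba = ≤-refl
links≤2 true  false true  true  no-ab no-ba = ⊥-elim (no-ab refl refl)
links≤2 true  false true  false no-ab no-ba = ≤-refl
links≤2 true  false false true  no-ab no-ba = ⊥-elim (no-ab refl refl)
links≤2 true  false false false no-ab no-ba = s≤s z≤n
links≤2 false true  true  true  no-ab no-ba = ⊥-elim (no-ba refl refl)
links≤2 false true  true  false no-ab no-ba = ⊥-elim (no-ba refl refl)
links≤2 false true  false true  no-ab no-ba = ≤-refl
links≤2 false true  false false no-ab no-ba = s≤s z≤n
links≤2 false false true  true  no-ab no-ba = ≤-refl
links≤2 false false true  false no-ab no-ba = s≤s z≤n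
links≤2 false false false true  no-ab no-ba = s≤s z≤n
links≤2 false false false false no-ab no-ba = z≤n

linkPattern : ∀ ua ub va vb → links ua ub va vb ≡ 2 →
              (ua ≡ true → vb ≡ true → ⊥) → (ub ≡ true → va ≡ true → ⊥) → LinkPattern ua ub va vb
linkPattern true  true  false false _ _     _     = both-u refl refl refl refl
linkPattern false false true  true  _ _     _     = both-v refl refl refl refl
linkPattern true  false true  false _ _     _     = via-a refl refl refl refl
linkPattern false true  false true  _ _     _     = via-b refl refl refl refl
linkPattern true  false false true  _ no-ab _     = ⊥-elim (no-ab refl refl)
linkPattern false true  true  false _ _     no-ba = ⊥-elim (no-ba refl refl)
linkPattern true  true  true  true  () _ _
linkPattern true  true  true  false () _ _
linkPattern true  true  false true  () _ _
linkPattern true  false true  true  () _ _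
linkPattern true  false false false () _ _
linkPattern false true  true  true  () _ _
linkPattern false true  false false () _ _
linkPattern false false true  false () _ _
linkPattern false false false true  () _ _
linkPattern false false false false () _ _

module DenseGraph {n : ℕ} (G : Graph n) (m : ℕ)
  (few-non-neighbours : ∀ v → count (not ∘ adj G v) ≤ suc m) where
  open Matchings G public
  open JoinOfTwoCliques G public

  Independentᵇ : (Fin n → Bool) → Set
  Independentᵇ p = ∀ x y → p x ≡ true → p y ≡ true → adj′ x y ≡ false

  neighbours-in-region : ∀ (H : Fin n → Bool) → count H ≡ 2 * m → ∀ x → m ≤ suc (count (λ w → H w ∧ adj′ x w))
  neighbours-in-region H H-size x = +-cancelʳ-≤ m m (suc A) (begin
    m + m                                                      ≡⟨ ≡.sym (≡.trans H-size (2*-double m)) ⟩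
    count H                                                    ≡⟨ count-split H (adj′ x) ⟩
    A + count (λ w → H w ∧ not (adj′ x w))                      ≤⟨ +-monoʳ-≤ A non-neighbours ⟩
    A + suc m                                                  ≡⟨ +-suc A m ⟩
    suc A + m                                                  ∎)
    where
    open ≤-Reasoning
    A : ℕ
    A = count (λ w → H w ∧ adj′ x w)
    non-neighbours : count (λ w → H w ∧ not (adj′ x w)) ≤ suc m
    non-neighbours = ≤-trans (count-mono _ _ (λ w → ∧-trueʳ {H w})) (few-non-neighbours x)

  -- x has at least m − 1 neighbours in H, all of them in Q ∖ {x}, which has exactly m − 1 elements.
  closed⇒adjacent-within : ∀ (H : Fin n → Bool) → count H ≡ 2 * m → (Q : Fin n → Bool) →
    (∀ w → Q w ≡ true → H w ≡ true) → count Q ≡ m →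
    ∀ x → Q x ≡ true → (∀ w → H w ≡ true → adj′ x w ≡ true → Q w ≡ true) →
    ∀ y → y ≢ x → Q y ≡ true → adj′ x y ≡ true
  closed⇒adjacent-within H H-size Q Q⊆H Q-size x Qx closed y y≢x Qy =
    ∧-trueʳ {H y} (⊆∧count≥⇒⊇ N[x] Q-x N[x]⊆Q-x Q-x≤N[x] y (∧-intro Qy (false⇒not-true (≢⇒==-false y≢x))))
    where
    N[x] Q-x : Fin n → Bool
    N[x] w = H w ∧ adj′ x w
    Q-x  w = Q w ∧ not (w == x)
    N[x]⊆Q-x : ∀ w → N[x] w ≡ true → Q-x w ≡ true
    N[x]⊆Q-x w xw = ∧-intro (closed w (∧-trueˡ xw) (∧-trueʳ {H w} xw))
                            (false⇒not-true (≢⇒==-false (adj⇒≢ (∧-trueʳ {H w} xw) ∘ ≡.sym)))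
    Q∧x : ∀ w → Q w ∧ (w == x) ≡ (w == x)
    Q∧x w with w ≟F x
    ... | yes refl rewrite Qx = refl
    ... | no _     = ∧-zeroʳ _
    Q-size′ : count Q ≡ 1 + count Q-x
    Q-size′ = ≡.trans (count-split Q (_== x)) (cong (_+ count Q-x) (≡.trans (count-cong _ _ Q∧x) (count-singleton x)))
    Q-x≤N[x] : count Q-x ≤ count N[x]
    Q-x≤N[x] = s≤s⁻¹ (subst (_≤ suc (count N[x])) (≡.trans (≡.sym Q-size) Q-size′) (neighbours-in-region H H-size x))

  -- y's at most m + 1 non-neighbours are already exhausted by Q ∪ {y}.
  nonadjacent-to⇒adjacent-outside : (Q : Fin n → Bool) → count Q ≡ m →
    ∀ y → Q y ≡ false → (∀ w → Q w ≡ true → adj′ y w ≡ false) →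
    ∀ x → x ≢ y → Q x ≡ false → adj′ y x ≡ true
  nonadjacent-to⇒adjacent-outside Q Q-size y Qy y≁Q x x≢y Qx with adj′ y x in yx
  ... | true  = refl
  ... | false = ⊥-elim (≡true⇒≢false (⊆∧count≥⇒⊇ Q+y (not ∘ adj′ y) Q+y⊆non-nbrs non-nbrs≤ x (false⇒not-true yx)) Q+y-x)
    where
    Q+y : Fin n → Bool
    Q+y w = Q w ∨ (w == y)
    Q+y⊆non-nbrs : ∀ w → Q+y w ≡ true → not (adj′ y w) ≡ true
    Q+y⊆non-nbrs w Q+yw with ∨-true {Q w} Q+yw
    ... | inj₁ Qw   = false⇒not-true (y≁Q w Qw)
    ... | inj₂ w==y = false⇒not-true (subst (λ t → adj′ y t ≡ false) (≡.sym (==⇒≡ w==y)) (adj-irrefl y))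
    on-y : ∀ w → Q+y w ∧ (w == y) ≡ (w == y)
    on-y w with w ≟F y
    ... | yes refl rewrite Qy = refl
    ... | no _     = ∧-zeroʳ _
    off-y : ∀ w → Q+y w ∧ not (w == y) ≡ Q w
    off-y w with w ≟F y
    ... | yes refl rewrite Qy = refl
    ... | no _     = ≡.trans (∧-identityʳ _) (∨-identityʳ _)
    Q+y-size : count Q+y ≡ suc m
    Q+y-size = ≡.trans (count-split Q+y (_== y))
                 (cong₂ _+_ (≡.trans (count-cong _ _ on-y) (count-singleton y)) (≡.trans (count-cong _ _ off-y) Q-size))
    non-nbrs≤ : count (not ∘ adj′ y) ≤ count Q+y
    non-nbrs≤ = subst (count (not ∘ adj′ y) ≤_) (≡.sym Q+y-size) (few-non-neighbours y)
    Q+y-x : Q+y x ≡ false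
    Q+y-x rewrite Qx = ≢⇒==-false x≢y

  -- u and v see at most two ends of each edge of M (no 3-path) and at least m − 1 vertices of M
  -- each, so |M| = m − 1 and every matched edge is joined to u, v in one of the four ways of
  -- LinkPattern. Both cases below then contradict α ≤ m or the excluded join.
  module NoAugmentingPath
    (H : Fin n → Bool) (H-size : count H ≡ 2 * m) {s} (outside-size : count (not ∘ H) ≡ s)
    (α-bound : ∀ p → Independentᵇ p → count p ≤ m)
    (notJoin : ¬ (Odd m × IsJoinOfTwoCliques G s m))
    (M : List (Pair n)) (isMatching : IsMatching G M) (inRegion : All (λ w → H w ≡ true) (V M))
    (M-small : suc (length M) ≤ m)
    (u v : Fin n) (u≢v : u ≢ v) (fu : free H M u ≡ true) (fv : free H M v ≡ true)
    (noFreeEdge : ∀ x y → free H M x ≡ true → free H M y ≡ true → adj′ x y ≡ false)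
    (no3Path : ∀ a b → (a , b) ∈ᵒ M → adj′ u a ≡ true → adj′ b v ≡ true → ⊥)
    (no5Path : ∀ a b c d → (a , b) ∈ᵒ M → (c , d) ∈ᵒ M → c ≢ a → c ≢ b
              → adj′ u a ≡ true → adj′ b c ≡ true → adj′ d v ≡ true → ⊥)
    where
    open Region G H

    j : ℕ
    j = length M

    M-unique : Unique (V M)
    M-unique = proj₂ isMatching

    H-u : H u ≡ true
    H-u = free⇒inRegion M fu
    H-v : H v ≡ true
    H-v = free⇒inRegion M fv

    free-neighbour⇒covered : ∀ x → free H M x ≡ true → ∀ w → H w ≡ true → adj′ x w ≡ true → w ∈ V M
    free-neighbour⇒covered x fx w hw e with inV M w in eq
    ... | true = inV⇒∈ M eq
    ... | false = ⊥-elim (≡true⇒≢false e (noFreeEdge x w fx (∧-intro hw (false⇒not-true eq))))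

    free-degree≤ : ∀ x → free H M x ≡ true → count (λ w → H w ∧ adj′ x w) ≤ countL (adj′ x) (V M)
    free-degree≤ x fx =
      ≤-trans (⊆⇒count≤countL _ (V M) (λ w hw → free-neighbour⇒covered x fx w (∧-trueˡ hw) (∧-trueʳ {H w} hw)))
              (countL-mono _ _ (V M) (λ w → ∧-trueʳ {H w}))

    links-to-uv : Pair n → ℕ
    links-to-uv e = links (adj′ u (proj₁ e)) (adj′ u (proj₂ e)) (adj′ v (proj₁ e)) (adj′ v (proj₂ e))

    du dv : ℕ
    du = countL (adj′ u) (V M)
    dv = countL (adj′ v) (V M)

    sum-links : du + dv ≡ sumMap links-to-uv M
    sum-links = ≡.trans (cong₂ _+_ (countL-V G (adj′ u) M) (countL-V G (adj′ v) M)) (sumMap-+ _ _ M)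

    no3Path′ : ∀ {a b} → (a , b) ∈ᵒ M → adj′ u a ≡ true → adj′ v b ≡ true → ⊥
    no3Path′ {a} {b} ab ua vb = no3Path a b ab ua (≡.trans (adj-sym b v) vb)

    links-to-uv≤2 : ∀ e → e ∈ M → links-to-uv e ≤ 2
    links-to-uv≤2 (a , b) mem = links≤2 _ _ _ _ (no3Path′ (inj₁ mem)) (no3Path′ {b} {a} (inj₂ mem))

    m≤1+du : m ≤ suc du
    m≤1+du = ≤-trans (neighbours-in-region H H-size u) (s≤s (free-degree≤ u fu))
    m≤1+dv : m ≤ suc dv
    m≤1+dv = ≤-trans (neighbours-in-region H H-size v) (s≤s (free-degree≤ v fv))

    du+dv≤2j : du + dv ≤ j + j
    du+dv≤2j = subst₂ _≤_ (≡.sym sum-links) (2*-double j) (sumMap≤2*length links-to-uv M links-to-uv≤2)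

    j≤du : j ≤ du
    j≤du = s≤s⁻¹ (≤-trans M-small m≤1+du)
    j≤dv : j ≤ dv
    j≤dv = s≤s⁻¹ (≤-trans M-small m≤1+dv)

    du≡j : du ≡ j
    du≡j = ≤-antisym (+-cancelʳ-≤ j du j (≤-trans (+-monoʳ-≤ du j≤dv) du+dv≤2j)) j≤du

    m≡1+j : m ≡ suc j
    m≡1+j = ≤-antisym (subst (λ t → m ≤ suc t) du≡j m≤1+du) M-small

    links-to-uv≡2 : ∀ e → e ∈ M → links-to-uv e ≡ 2
    links-to-uv≡2 = sumMap-tight links-to-uv M links-to-uv≤2
      (subst₂ _≤_ (≡.sym (2*-double j)) sum-links (+-mono-≤ j≤du j≤dv))

    u-degree≡j : count (λ w → H w ∧ adj′ u w) ≡ j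
    u-degree≡j = ≤-antisym (≤-trans (free-degree≤ u fu) (≤-reflexive du≡j))
                           (s≤s⁻¹ (≤-trans M-small (neighbours-in-region H H-size u)))

    linkPatternᵒ : ∀ {a b} → (a , b) ∈ᵒ M → LinkPattern (adj′ u a) (adj′ u b) (adj′ v a) (adj′ v b)
    linkPatternᵒ {a} {b} (inj₁ mem) =
      linkPattern _ _ _ _ (links-to-uv≡2 (a , b) mem) (no3Path′ (inj₁ mem)) (no3Path′ {b} {a} (inj₂ mem))
    linkPatternᵒ {a} {b} (inj₂ mem) =
      linkPattern _ _ _ _ (≡.trans (links-swap (adj′ u a) (adj′ u b) (adj′ v a) (adj′ v b)) (links-to-uv≡2 (b , a) mem))
                                (no3Path′ {a} {b} (inj₂ mem)) (no3Path′ {b} {a} (inj₁ mem))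

    count-free≡2 : count (free H M) ≡ 2
    count-free≡2 = +-cancelʳ-≡ (2 * j) (count (free H M)) 2
      (≡.trans (count-free (regionMatching M isMatching inRegion refl))
               (≡.trans H-size (≡.trans (cong (2 *_) m≡1+j) (*-suc 2 j))))

    isEnd : Fin n → Bool
    isEnd w = (w == u) ∨ (w == v)

    end⇒free : ∀ w → isEnd w ≡ true → free H M w ≡ true
    end⇒free w e with w ≟F u | w ≟F v
    ... | yes refl | _ = fu
    ... | no _ | yes refl = fv
    ... | no _ | no _ = ⊥-elim (≡true⇒≢false e refl)

    free⇒end : ∀ w → free H M w ≡ true → w ≡ u ⊎ w ≡ v
    free⇒end w fw with ∨-true {w == u} (⊆∧count≥⇒⊇ isEnd (free H M) end⇒free
                      (≤-reflexive (≡.trans count-free≡2 (≡.sym (count-pair u v u≢v)))) w fw)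
    ... | inj₁ e = inj₁ (==⇒≡ e)
    ... | inj₂ e = inj₂ (==⇒≡ e)

    covered-unless-end : ∀ w → H w ≡ true → w ≢ u → w ≢ v → w ∈ V M
    covered-unless-end w hw wu wv with inV M w in eq
    ... | true = inV⇒∈ M eq
    ... | false with free⇒end w (∧-intro hw (false⇒not-true eq))
    ... | inj₁ e = ⊥-elim (wu e)
    ... | inj₂ e = ⊥-elim (wv e)

    free-apart-from-V : ∀ x → free H M x ≡ true → All (x ≢_) (V M)
    free-apart-from-V x fx = All.tabulate (λ {w} mem e → free⇒∉V M fx (subst (_∈ V M) (≡.sym e) mem))

    unique-ends-V : Unique (u ∷ v ∷ V M)
    unique-ends-V = (u≢v ∷ free-apart-from-V u fu) ∷ (free-apart-from-V v fv ∷ M-unique)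

    commonNeighbour? : Dec (∃[ a ] ∃[ b ] ((a , b) ∈ᵒ M × adj′ u a ≡ true × adj′ v a ≡ true))
    commonNeighbour? = any? (λ a → any? (λ b → ∈ᵒ-dec a b M ×-dec (≟true (adj′ u a) ×-dec ≟true (adj′ v a))))

    -- z misses u, v and at least 1 + bothEnds e vertices of each matched edge e; as it misses at
    -- most m + 1 = |M| + 2 vertices, every matched edge has an end adjacent to neither u nor v.
    module CommonNeighbour
      (x z : Fin n) (xz : (x , z) ∈ᵒ M) (u~x : adj′ u x ≡ true) (v~x : adj′ v x ≡ true) where
      u≁z : adj′ u z ≡ false
      u≁z with linkPatternᵒ xz
      ... | both-u _ _ e _ = ⊥-elim (≡true⇒≢false v~x e)
      ... | both-v e _ _ _ = ⊥-elim (≡true⇒≢false u~x e)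
      ... | via-a _ e _ _ = e
      ... | via-b e _ _ _ = ⊥-elim (≡true⇒≢false u~x e)
      v≁z : adj′ v z ≡ false
      v≁z with linkPatternᵒ xz
      ... | both-u _ _ e _ = ⊥-elim (≡true⇒≢false v~x e)
      ... | both-v e _ _ _ = ⊥-elim (≡true⇒≢false u~x e)
      ... | via-a _ _ _ e = e
      ... | via-b e _ _ _ = ⊥-elim (≡true⇒≢false u~x e)
      x~v : adj′ x v ≡ true
      x~v = ≡.trans (adj-sym x v) v~x

      bothEnds : Pair n → ℕ
      bothEnds e = toℕ (adj′ u (proj₁ e) ∧ adj′ u (proj₂ e)) + toℕ (adj′ v (proj₁ e) ∧ adj′ v (proj₂ e))
      missed-by-z : Pair n → ℕ
      missed-by-z e = toℕ (not (adj′ z (proj₁ e))) + toℕ (not (adj′ z (proj₂ e)))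

      z≁a-via-u : ∀ {a b} → (a , b) ∈ᵒ M → z ≢ a → z ≢ b → adj′ u b ≡ true → adj′ z a ≡ false
      z≁a-via-u {a} {b} ab z≢a z≢b ub =
        ¬-not λ za → no5Path b a z x (∈ᵒ-flip ab) (∈ᵒ-flip xz) z≢b z≢a ub (≡.trans (adj-sym a z) za) x~v

      z≁a-via-v : ∀ {a b} → (a , b) ∈ᵒ M → z ≢ a → adj′ u a ≡ false → adj′ v b ≡ true → adj′ z a ≡ false
      z≁a-via-v {a} {b} ab z≢a ua vb =
        ¬-not λ za → no5Path x z a b xz ab a≢x (z≢a ∘ ≡.sym) u~x za (≡.trans (adj-sym b v) vb)
        where
        a≢x : a ≢ x
        a≢x refl = ≡true⇒≢false u~x ua

      missed-by-z≥ : ∀ a b → (a , b) ∈ᵒ M → 1 + bothEnds (a , b) ≤ missed-by-z (a , b)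
      missed-by-z≥ a b ab with z ≟F a
      ... | yes refl rewrite u≁z | v≁z | adj-irrefl z = s≤s z≤n
      ... | no z≢a with z ≟F b
      ... | yes refl rewrite u≁z | v≁z | adj-irrefl z | ∧-zeroʳ (adj′ u a) | ∧-zeroʳ (adj′ v a) = m≤n+m 1 _
      ... | no z≢b with linkPatternᵒ ab
      ... | both-u ua ub va vb
            rewrite ua | ub | va | z≁a-via-u ab z≢a z≢b ub | z≁a-via-u (∈ᵒ-flip ab) z≢b z≢a ua = ≤-refl
      ... | both-v ua ub va vb
            rewrite ua | va | vb | z≁a-via-v ab z≢a ua vb | z≁a-via-v (∈ᵒ-flip ab) z≢b ub va = ≤-refl
      ... | via-a ua ub va vb
            rewrite ua | ub | va | vb | z≁a-via-u (∈ᵒ-flip ab) z≢b z≢a ua = m≤n+m 1 _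
      ... | via-b ua ub va vb
            rewrite ua | va | z≁a-via-u ab z≢a z≢b ub = s≤s z≤n

      z≁u : adj′ z u ≡ false
      z≁u = ≡.trans (adj-sym z u) u≁z
      z≁v : adj′ z v ≡ false
      z≁v = ≡.trans (adj-sym z v) v≁z

      missed-by-z≤ : 2 + sumMap missed-by-z M ≤ suc m
      missed-by-z≤ = begin
        2 + sumMap missed-by-z M               ≡⟨ cong (2 +_) (≡.sym (countL-V G (not ∘ adj′ z) M)) ⟩
        2 + countL (not ∘ adj′ z) (V M)        ≡⟨ cong₂ (λ a b → toℕ (not a) + (toℕ (not b) + countL (not ∘ adj′ z) (V M)))
                                                        (≡.sym z≁u) (≡.sym z≁v) ⟩
        countL (not ∘ adj′ z) (u ∷ v ∷ V M)    ≤⟨ unique⇒countL≤count (not ∘ adj′ z) (u ∷ v ∷ V M) unique-ends-V ⟩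
        count (not ∘ adj′ z)                   ≤⟨ few-non-neighbours z ⟩
        suc m                                  ∎
        where open ≤-Reasoning

      sum-missed-by-z≥ : j + sumMap bothEnds M ≤ sumMap missed-by-z M
      sum-missed-by-z≥ = subst (_≤ sumMap missed-by-z M) (sumMap-suc bothEnds M)
                (sumMap-mono (λ e → 1 + bothEnds e) missed-by-z M (λ { (a , b) mem → missed-by-z≥ a b (inj₁ mem) }))

      sum-bothEnds≤0 : sumMap bothEnds M ≤ 0
      sum-bothEnds≤0 = +-cancelˡ-≤ (2 + j) _ 0 (begin
        2 + j + sumMap bothEnds M  ≤⟨ +-monoʳ-≤ 2 sum-missed-by-z≥ ⟩
        2 + sumMap missed-by-z M   ≤⟨ missed-by-z≤ ⟩
        suc m                      ≡⟨ cong suc m≡1+j ⟩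
        2 + j                      ≡⟨ ≡.sym (+-identityʳ (2 + j)) ⟩
        2 + j + 0                  ∎)
        where open ≤-Reasoning

      no-both-u : ∀ {a b} → (a , b) ∈ M → adj′ u a ∧ adj′ u b ≡ false
      no-both-u ab = toℕ≡0⇒false (m+n≡0⇒m≡0 _ (sumMap≤0⇒≡0 bothEnds M sum-bothEnds≤0 _ ab))

      no-both-v : ∀ {a b} → (a , b) ∈ M → adj′ v a ∧ adj′ v b ≡ false
      no-both-v ab = toℕ≡0⇒false (m+n≡0⇒n≡0 _ (sumMap≤0⇒≡0 bothEnds M sum-bothEnds≤0 _ ab))

      remote : Fin n → Bool
      remote w = H w ∧ (not (adj′ u w) ∧ not (adj′ v w))

      remote⇒u≁ : ∀ w → remote w ≡ true → adj′ u w ≡ false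
      remote⇒u≁ w ow = not-true⇒false (∧-trueˡ (∧-trueʳ {H w} ow))
      remote⇒v≁ : ∀ w → remote w ≡ true → adj′ v w ≡ false
      remote⇒v≁ w ow = not-true⇒false (∧-trueʳ {not (adj′ u w)} (∧-trueʳ {H w} ow))
      remote⇒H : ∀ w → remote w ≡ true → H w ≡ true
      remote⇒H w ow = ∧-trueˡ ow

      remote-endpoint : ∀ e → e ∈ M → 1 ≤ toℕ (remote (proj₁ e)) + toℕ (remote (proj₂ e))
      remote-endpoint (a , b) mem with linkPatternᵒ (inj₁ mem)
      ... | both-u ua ub _ _ = ⊥-elim (≡true⇒≢false (∧-intro ua ub) (no-both-u mem))
      ... | both-v _ _ va vb = ⊥-elim (≡true⇒≢false (∧-intro va vb) (no-both-v mem))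
      ... | via-a _ ub _ vb = ≤-trans (≤-reflexive (≡.sym (cong toℕ remote-b))) (m≤n+m _ _)
        where
        remote-b : remote b ≡ true
        remote-b = ∧-intro (All.lookup inRegion (∈⇒∈V₂ mem)) (∧-intro (false⇒not-true ub) (false⇒not-true vb))
      ... | via-b ua _ va _ = ≤-trans (≤-reflexive (≡.sym (cong toℕ remote-a))) (m≤m+n _ _)
        where
        remote-a : remote a ≡ true
        remote-a = ∧-intro (All.lookup inRegion (∈⇒∈V₁ mem)) (∧-intro (false⇒not-true ua) (false⇒not-true va))

      remote-u : remote u ≡ true
      remote-u = ∧-intro H-u (∧-intro (false⇒not-true (adj-irrefl u)) (false⇒not-true (noFreeEdge v u fv fu)))
      remote-v : remote v ≡ true
      remote-v = ∧-intro H-v (∧-intro (false⇒not-true (noFreeEdge u v fu fv)) (false⇒not-true (adj-irrefl v)))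

      count-remote : suc m ≤ count remote
      count-remote = begin
        suc m                        ≡⟨ cong suc m≡1+j ⟩
        2 + j                        ≤⟨ +-monoʳ-≤ 2 (subst (j ≤_) (≡.sym (countL-V G remote M))
                                                           (length≤sumMap _ M remote-endpoint)) ⟩
        2 + countL remote (V M)      ≡⟨ cong₂ (λ a b → toℕ a + (toℕ b + countL remote (V M)))
                                              (≡.sym remote-u) (≡.sym remote-v) ⟩
        countL remote (u ∷ v ∷ V M)  ≤⟨ unique⇒countL≤count remote (u ∷ v ∷ V M) unique-ends-V ⟩
        count remote                 ∎
        where open ≤-Reasoning

      remote-partner-u : ∀ {a w} → (a , w) ∈ᵒ M → adj′ u w ≡ false → adj′ v w ≡ false → adj′ u a ≡ true
      remote-partner-u aw uw vw with linkPatternᵒ aw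
      ... | both-u _ e _ _ = ⊥-elim (≡true⇒≢false e uw)
      ... | both-v _ _ _ e = ⊥-elim (≡true⇒≢false e vw)
      ... | via-a e _ _ _ = e
      ... | via-b _ e _ _ = ⊥-elim (≡true⇒≢false e uw)
      remote-partner-v : ∀ {a w} → (a , w) ∈ᵒ M → adj′ u w ≡ false → adj′ v w ≡ false → adj′ v a ≡ true
      remote-partner-v aw uw vw with linkPatternᵒ aw
      ... | both-u _ e _ _ = ⊥-elim (≡true⇒≢false e uw)
      ... | both-v _ _ _ e = ⊥-elim (≡true⇒≢false e vw)
      ... | via-a _ _ e _ = e
      ... | via-b _ e _ _ = ⊥-elim (≡true⇒≢false e uw)

      remote-nonadjacent : ∀ w w' → remote w ≡ true → remote w' ≡ true → adj′ w w' ≡ true → ⊥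
      remote-nonadjacent w w' ow ow' e with w ≟F u | w ≟F v | w' ≟F u | w' ≟F v
      ... | yes refl | _ | _ | _ = ≡true⇒≢false e (remote⇒u≁ w' ow')
      ... | no _ | yes refl | _ | _ = ≡true⇒≢false e (remote⇒v≁ w' ow')
      ... | no _ | no _ | yes refl | _ = ≡true⇒≢false (≡.trans (adj-sym u w) e) (remote⇒u≁ w ow)
      ... | no _ | no _ | no _ | yes refl = ≡true⇒≢false (≡.trans (adj-sym v w) e) (remote⇒v≁ w ow)
      ... | no wu | no wv | no w'u | no w'v =
          let (a , aw) = ∈V⇒partner M (covered-unless-end w (remote⇒H w ow) wu wv)
              (b' , bw') = ∈V⇒partner M (covered-unless-end w' (remote⇒H w' ow') w'u w'v)
              ua = remote-partner-u aw (remote⇒u≁ w ow) (remote⇒v≁ w ow)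
              vb' = remote-partner-v bw' (remote⇒u≁ w' ow') (remote⇒v≁ w' ow')
          in no5Path a w w' b' aw (∈ᵒ-flip bw')
               (λ e' → ≡true⇒≢false (subst (λ t → adj′ u t ≡ true) (≡.sym e') ua) (remote⇒u≁ w' ow'))
               (λ e' → ≡true⇒≢false (subst (λ t → adj′ w t ≡ true) e' e) (adj-irrefl w))
               ua e (≡.trans (adj-sym b' v) vb')

      remote-independent : Independentᵇ remote
      remote-independent w w' ow ow' = ¬-not (remote-nonadjacent w w' ow ow')

      impossible : ⊥
      impossible = <-irrefl refl (≤-trans count-remote (α-bound remote remote-independent))

    -- Now u is joined to both or neither end of each matched edge, so m − 1 = |N(u) ∩ V(M)| is even,
    -- and N[u] ∩ H and H ∖ N[u] are cliques of size m with no edges between them.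
    module NoCommonNeighbour
      (noCommon : ∀ a b → (a , b) ∈ᵒ M → adj′ u a ≡ true → adj′ v a ≡ true → ⊥) where
      u~b⇒u~a : ∀ {a b} → (a , b) ∈ᵒ M → adj′ u b ≡ true → adj′ u a ≡ true × adj′ v b ≡ false
      u~b⇒u~a ab ub with linkPatternᵒ ab
      ... | both-u ua _ _ vb = ua , vb
      ... | both-v _ e _ _ = ⊥-elim (≡true⇒≢false ub e)
      ... | via-a _ e _ _ = ⊥-elim (≡true⇒≢false ub e)
      ... | via-b _ e _ vb = ⊥-elim (noCommon _ _ (∈ᵒ-flip ab) e vb)

      u≁b⇒v~a : ∀ {a b} → (a , b) ∈ᵒ M → adj′ u b ≡ false → adj′ v a ≡ true
      u≁b⇒v~a ab ub with linkPatternᵒ ab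
      ... | both-u _ e _ _ = ⊥-elim (≡true⇒≢false e ub)
      ... | both-v _ _ va _ = va
      ... | via-a ua _ va _ = ⊥-elim (noCommon _ _ ab ua va)
      ... | via-b _ e _ _ = ⊥-elim (≡true⇒≢false e ub)

      N[u] : Fin n → Bool
      N[u] w = (w == u) ∨ adj′ u w
      g₁ g₂ : Fin n → Bool
      g₁ w = H w ∧ N[u] w
      g₂ w = H w ∧ not (N[u] w)

      g₂-info : ∀ w → g₂ w ≡ true → H w ≡ true × w ≢ u × adj′ u w ≡ false
      g₂-info w e =
        let qf = not-true⇒false (∧-trueʳ {H w} e)
            (a1 , a2) = ∨-false {w == u} qf
        in ∧-trueˡ e , (λ wu → ≡true⇒≢false (subst (λ t → (t == u) ≡ true) (≡.sym wu) (==-refl u)) a1) , a2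

      g₁-info : ∀ w → g₁ w ≡ true → H w ≡ true × (w ≡ u ⊎ adj′ u w ≡ true)
      g₁-info w e with ∨-true {w == u} (∧-trueʳ {H w} e)
      ... | inj₁ x = ∧-trueˡ e , inj₁ (==⇒≡ x)
      ... | inj₂ x = ∧-trueˡ e , inj₂ x

      g₂-from : ∀ w → H w ≡ true → g₁ w ≡ false → g₂ w ≡ true
      g₂-from w hw g with N[u] w in eq
      ... | true rewrite hw = ⊥-elim (≡true⇒≢false refl g)
      ... | false rewrite hw = refl

      g₁g₂-nonadjacent′ : ∀ w1 w2 → g₁ w1 ≡ true → g₂ w2 ≡ true → adj′ w1 w2 ≡ true → ⊥
      g₁g₂-nonadjacent′ w1 w2 g1w g2w e with g₁-info w1 g1w | g₂-info w2 g2w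
      ... | _ , inj₁ refl | _ , _ , uw2 = ≡true⇒≢false e uw2
      ... | hw1 , inj₂ uw1 | hw2 , w2u , uw2 =
          let (a , aw1) = ∈V⇒partner M (free-neighbour⇒covered u fu w1 hw1 uw1)
              (ua , vw1) = u~b⇒u~a aw1 uw1
          in go a aw1 ua vw1
        where
        go : ∀ a → (a , w1) ∈ᵒ M → adj′ u a ≡ true → adj′ v w1 ≡ false → ⊥
        go a aw1 ua vw1 with w2 ≟F v
        ... | yes refl = ≡true⇒≢false (≡.trans (adj-sym v w1) e) vw1
        ... | no w2v =
            let (d , dw2) = ∈V⇒partner M (covered-unless-end w2 hw2 w2u w2v)
                vd = u≁b⇒v~a dw2 uw2
            in no5Path a w1 w2 d aw1 (∈ᵒ-flip dw2)
                 (λ e' → ≡true⇒≢false (subst (λ t → adj′ u t ≡ true) (≡.sym e') ua) uw2)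
                 (λ e' → ≡true⇒≢false (subst (λ t → adj′ u t ≡ true) (≡.sym e') uw1) uw2)
                 ua e (≡.trans (adj-sym d v) vd)

      g₁g₂-nonadjacent : ∀ w1 w2 → g₁ w1 ≡ true → g₂ w2 ≡ true → adj′ w1 w2 ≡ false
      g₁g₂-nonadjacent w1 w2 a b = ¬-not (g₁g₂-nonadjacent′ w1 w2 a b)

      on-u : ∀ w → g₁ w ∧ (w == u) ≡ (w == u)
      on-u w with w ≟F u
      ... | yes refl rewrite H-u = refl
      ... | no _ = ∧-zeroʳ _
      off-u : ∀ w → g₁ w ∧ not (w == u) ≡ (H w ∧ adj′ u w)
      off-u w with w ≟F u
      ... | yes refl rewrite H-u | adj-irrefl u = refl
      ... | no _ = ∧-identityʳ _

      g₁-size : count g₁ ≡ m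
      g₁-size = begin
        count g₁                                                       ≡⟨ count-split g₁ (_== u) ⟩
        count (λ w → g₁ w ∧ (w == u)) + count (λ w → g₁ w ∧ not (w == u))
                                                                       ≡⟨ cong₂ _+_ (count-cong _ _ on-u) (count-cong _ _ off-u) ⟩
        count (_== u) + count (λ w → H w ∧ adj′ u w)                    ≡⟨ cong₂ _+_ (count-singleton u) u-degree≡j ⟩
        suc j                                                          ≡⟨ ≡.sym m≡1+j ⟩
        m                                                              ∎
        where open ≡-Reasoning

      g₂-size : count g₂ ≡ m
      g₂-size = +-cancelˡ-≡ m (count g₂) m (≡.trans (cong (_+ count g₂) (≡.sym g₁-size))
              (≡.trans (≡.sym (count-split H N[u])) (≡.trans H-size (2*-double m))))

      not-split : ∀ a b → not (a ∧ b) ∧ not (a ∧ not b) ≡ not a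
      not-split true true = refl
      not-split true false = refl
      not-split false b = refl

      rest-size : count (λ x → not (g₁ x) ∧ not (g₂ x)) ≡ s
      rest-size = ≡.trans (count-cong _ _ (λ x → not-split (H x) (N[u] x))) outside-size

      g₁⇒¬g₂ : ∀ x → g₁ x ≡ true → g₂ x ≡ false
      g₁⇒¬g₂ x e = ≡.trans (cong (λ t → H x ∧ not t) (∧-trueʳ {H x} e)) (∧-zeroʳ (H x))

      g₁-clique : ∀ x y → x ≢ y → g₁ x ≡ true → g₁ y ≡ true → adj′ x y ≡ true
      g₁-clique x y xy gx gy = closed⇒adjacent-within H H-size g₁ (λ w → ∧-trueˡ) g₁-size x gx cl y (xy ∘ ≡.sym) gy
        where
        cl : ∀ w → H w ≡ true → adj′ x w ≡ true → g₁ w ≡ true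
        cl w hw e with g₁ w in eq
        ... | true = refl
        ... | false = ⊥-elim (≡true⇒≢false e (g₁g₂-nonadjacent x w gx (g₂-from w hw eq)))

      g₂-clique : ∀ x y → x ≢ y → g₂ x ≡ true → g₂ y ≡ true → adj′ x y ≡ true
      g₂-clique x y xy gx gy = closed⇒adjacent-within H H-size g₂ (λ w → ∧-trueˡ) g₂-size x gx cl y (xy ∘ ≡.sym) gy
        where
        cl : ∀ w → H w ≡ true → adj′ x w ≡ true → g₂ w ≡ true
        cl w hw e with g₁ w in eq
        ... | true = ⊥-elim (≡true⇒≢false (≡.trans (adj-sym w x) e) (g₁g₂-nonadjacent w x eq gx))
        ... | false = g₂-from w hw eq

      outside-H : ∀ x → g₁ x ≡ false → g₂ x ≡ false → H x ≡ false
      outside-H x a b with H x in eq | N[u] x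
      ... | true | true = ⊥-elim (≡true⇒≢false refl a)
      ... | true | false = ⊥-elim (≡true⇒≢false refl b)
      ... | false | _ = refl

      joined : ∀ x y → g₁ x ≡ false → g₂ x ≡ false → g₁ y ∨ g₂ y ≡ true → adj′ x y ≡ true
      joined x y a b gy with ∨-true {g₁ y} gy
      ... | inj₁ g1y = ≡.trans (adj-sym x y)
                         (nonadjacent-to⇒adjacent-outside g₂ g₂-size y (g₁⇒¬g₂ y g1y) (λ w → g₁g₂-nonadjacent y w g1y) x xy b)
        where
        xy : x ≢ y
        xy e' = ≡true⇒≢false (∧-trueˡ g1y) (subst (λ t → H t ≡ false) e' (outside-H x a b))
      ... | inj₂ g2y = ≡.trans (adj-sym x y)
                         (nonadjacent-to⇒adjacent-outside g₁ g₁-size y g1y′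
                            (λ w e → ≡.trans (adj-sym y w) (g₁g₂-nonadjacent w y e g2y)) x xy a)
        where
        xy : x ≢ y
        xy e' = ≡true⇒≢false (∧-trueˡ g2y) (subst (λ t → H t ≡ false) e' (outside-H x a b))
        g1y′ : g₁ y ≡ false
        g1y′ with g₁ y in eq
        ... | true = ⊥-elim (≡true⇒≢false g2y (g₁⇒¬g₂ y eq))
        ... | false = refl

      m-odd : Odd m
      m-odd = let (t , et) = sumMap-even u-links M u-links-even
            in t , ≡.trans m≡1+j (cong suc (≡.trans (≡.sym du≡j) (≡.trans (countL-V G (adj′ u) M) et)))
        where
        u-links : Pair n → ℕ
        u-links e = toℕ (adj′ u (proj₁ e)) + toℕ (adj′ u (proj₂ e))
        u-links-even : ∀ e → e ∈ M → u-links e ≡ 0 ⊎ u-links e ≡ 2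
        u-links-even (a , b) mem with linkPatternᵒ (inj₁ mem)
        ... | both-u ua ub _ _ rewrite ua | ub = inj₂ refl
        ... | both-v ua ub _ _ rewrite ua | ub = inj₁ refl
        ... | via-a ua _ va _ = ⊥-elim (noCommon a b (inj₁ mem) ua va)
        ... | via-b _ ub _ vb = ⊥-elim (noCommon b a (inj₂ mem) ub vb)

      impossible : ⊥
      impossible = notJoin (m-odd , isJoinOfTwoCliques-intro g₁ g₂ s m g₁⇒¬g₂ rest-size g₁-size g₂-size
                                      g₁-clique g₂-clique g₁g₂-nonadjacent joined)

    impossible : ⊥
    impossible with commonNeighbour?
    ... | yes (x , z , xz , u~x , v~x) = CommonNeighbour.impossible x z xz u~x v~x
    ... | no nc = NoCommonNeighbour.impossible (λ a b ab ua va → nc (a , b , ab , ua , va))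

  α≤⇒count≤ : IndependenceNumberAtMost G m → ∀ p → Independentᵇ p → count p ≤ m
  α≤⇒count≤ α p p-independent =
    subst (_≤ m) (∣tabulate∣≡count p)
      (α (tabulate p) (λ x y x∈ y∈ → p-independent x y (∈-tabulate p x∈) (∈-tabulate p y∈)))

  -- An independent set containing x consists of non-neighbours of x, so has at most m + 1 elements.
  no-large-independent⇒α≤ : (∀ T → Independentᵇ T → count T ≡ suc m → ⊥) → IndependenceNumberAtMost G m
  no-large-independent⇒α≤ none I I-independent with ∣ I ∣ ≤? m
  ... | yes ∣I∣≤m = ∣I∣≤m
  ... | no  ∣I∣≰m = ⊥-elim (none (lookup I) T-independent (≤-antisym T≤1+m 1+m≤T))
    where
    T-independent : Independentᵇ (lookup I)
    T-independent x y Tx Ty = I-independent x y (lookup⇒∈ₛ I Tx) (lookup⇒∈ₛ I Ty)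
    1+m≤T : suc m ≤ count (lookup I)
    1+m≤T = subst (suc m ≤_) (∣∣≡count-lookup I) (≰⇒> ∣I∣≰m)
    T≤1+m : count (lookup I) ≤ suc m
    T≤1+m with count-pos⇒∃ (lookup I) (≤-trans (s≤s z≤n) 1+m≤T)
    ... | x , Tx = ≤-trans (count-mono _ _ (λ w Tw → false⇒not-true (T-independent x w Tx Tw))) (few-non-neighbours x)

  -- Without a free edge, any free x has all free vertices among its at most m + 1 non-neighbours.
  greedyStep : ∀ {W : Fin n → Bool} {j} (mm : RegionMatching G W j) →
               2 + m ≤ count (Region.Free G W mm) → RegionMatching G W (suc j)
  greedyStep {W} mm many-free with Region.freeEdge? G W (edges mm)
  ... | yes (x , y , fx , fy , xy) = Region.extendByEdge G W mm fx fy xy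
  ... | no  no-free-edge with count-pos⇒∃ (Region.Free G W mm) (≤-trans (s≤s z≤n) many-free)
  ...   | x , fx = ⊥-elim (<-irrefl refl (≤-trans many-free (≤-trans
            (count-mono (Region.Free G W mm) (not ∘ adj′ x)
               (λ w fw → false⇒not-true (¬-not (λ xw → no-free-edge (x , w , fx , fw , xw)))))
            (few-non-neighbours x))))

  regionPerfectMatching : (H : Fin n → Bool) → count H ≡ 2 * m → ∀ {s} → count (not ∘ H) ≡ s →
    (∀ p → Independentᵇ p → count p ≤ m) → ¬ (Odd m × IsJoinOfTwoCliques G s m) → RegionMatching G H m
  regionPerfectMatching H H-size outside-size α-bound notJoin = grow m ≤-refl
    where
    open Region G H

    two-free : ∀ {j} (mm : RegionMatching G H j) → suc j ≤ m → 2 ≤ count (Free mm)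
    two-free {j} mm j<m = +-cancelʳ-≤ (2 * j) 2 _ (begin
      2 + 2 * j              ≡⟨ ≡.sym (*-suc 2 j) ⟩
      2 * suc j              ≤⟨ *-monoʳ-≤ 2 j<m ⟩
      2 * m                  ≡⟨ ≡.trans (≡.sym H-size) (≡.sym (count-free mm)) ⟩
      count (Free mm) + 2 * j ∎)
      where open ≤-Reasoning

    augmentStep : ∀ {j} → RegionMatching G H j → suc j ≤ m → RegionMatching G H (suc j)
    augmentStep {j} mm@(regionMatching M isM inH size) j<m with count≥2⇒∃-distinct (free H M) (two-free mm j<m)
    ... | u , v , u≢v , fu , fv with freeEdge? M
    ...   | yes (x , y , fx , fy , xy) = extendByEdge mm fx fy xy
    ...   | no no-free-edge with path3? M u v
    ...     | yes (a , b , ab , ua , bv) = augment3 mm fu fv u≢v ab ua bv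
    ...     | no no-3-path with path5? M u v
    ...       | yes (a , b , c , d , ab , cd , c≢a , c≢b , ua , bc , dv) = augment5 mm fu fv u≢v ab cd c≢a c≢b ua bc dv
    ...       | no no-5-path =
      ⊥-elim (NoAugmentingPath.impossible H H-size outside-size α-bound notJoin M isM inH
                (subst (λ t → suc t ≤ m) (≡.sym size) j<m) u v u≢v fu fv
                (λ x y fx fy → ¬-not (λ xy → no-free-edge (x , y , fx , fy , xy)))
                (λ a b ab ua bv → no-3-path (a , b , ab , ua , bv))
                (λ a b c d ab cd c≢a c≢b ua bc dv → no-5-path (a , b , c , d , ab , cd , c≢a , c≢b , ua , bc , dv)))

    grow : ∀ j → j ≤ m → RegionMatching G H j
    grow zero    _   = emptyMatching
    grow (suc j) j<m = augmentStep (grow j (≤-trans (n≤1+n j) j<m)) j<m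

-- The three conditions for ν = 2k + 2m

module Equivalences {n : ℕ} (G : Graph n) (k m : ℕ)
  (few-non-neighbours : ∀ v → count (not ∘ adj G v) ≤ suc m)
  (n≡2k+2m : n ≡ 2 * k + 2 * m) (1≤m : 1 ≤ m) (m≤k : m ≤ k)
  (notJoin : ¬ (Odd m × IsJoinOfTwoCliques G (2 * k) m)) where
  open DenseGraph G m few-non-neighbours

  Extensions : Set
  Extensions = ∀ M → IsMatching G M → length M ≡ k → ∃[ P ] (IsPerfectMatching G P × _⊆ₘ_ G M P)

  everything : Fin n → Bool
  everything _ = true

  ∣V∣≡2k : ∀ {M} → IsMatching G M → length M ≡ k → ∣ tabulate (inV M) ∣ ≡ 2 * k
  ∣V∣≡2k {M} M-matching M-size =
    ≡.trans (∣tabulate∣≡count (inV M))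
            (Region.count-covered G everything (regionMatching M M-matching (All.tabulate (λ _ → refl)) M-size))

  α≤⇒factorCritical : IndependenceNumberAtMost G m → FactorCritical G (2 * k)
  α≤⇒factorCritical α S S-size =
    edges mm , RegionMatching.isMatching mm
    , All.map (λ H-w w∈S → ≡true⇒≢false (∈ₛ⇒lookup S w∈S) (not-true⇒false H-w)) (RegionMatching.inRegion mm)
    , λ w w∉S → Region.perfect⇒covers G H mm H-size w (false⇒not-true (¬-not (w∉S ∘ lookup⇒∈ₛ S)))
    where
    H : Fin n → Bool
    H = not ∘ lookup S
    S-size′ : count (lookup S) ≡ 2 * k
    S-size′ = ≡.trans (≡.sym (∣∣≡count-lookup S)) S-size
    H-size : count H ≡ 2 * m
    H-size = +-cancelˡ-≡ (2 * k) (count H) (2 * m)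
               (≡.trans (cong (_+ count H) (≡.sym S-size′)) (≡.trans (count-complement (lookup S)) n≡2k+2m))
    outside-size : count (not ∘ H) ≡ 2 * k
    outside-size = ≡.trans (count-cong _ _ (not-involutive ∘ lookup S)) S-size′
    mm = regionPerfectMatching H H-size outside-size (α≤⇒count≤ α) notJoin

  kMatching : RegionMatching G everything k
  kMatching = grow k ≤-refl
    where
    grow : ∀ j → j ≤ k → RegionMatching G everything j
    grow zero    _   = Region.emptyMatching G everything
    grow (suc j) j<k = greedyStep mm (+-cancelʳ-≤ (2 * j) _ _ (begin
      2 + m + 2 * j                             ≡⟨ reorder m j ⟩
      2 * suc j + m                             ≤⟨ +-mono-≤ (*-monoʳ-≤ 2 j<k) (m≤n*m m 2) ⟩
      2 * k + 2 * m                             ≡⟨ ≡.sym (≡.trans count-true n≡2k+2m) ⟩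
      count everything                          ≡⟨ ≡.sym (Region.count-free G everything mm) ⟩
      count (Region.Free G everything mm) + 2 * j ∎))
      where
      open ≤-Reasoning
      mm = grow j (≤-trans (n≤1+n j) j<k)
      reorder : ∀ m j → 2 + m + 2 * j ≡ 2 * suc j + m
      reorder = solve-∀

  factorCritical⇒extensions : FactorCritical G (2 * k) → Extensions
  factorCritical⇒extensions fc M M-matching M-size with fc (tabulate (inV M)) (∣V∣≡2k M-matching M-size)
  ... | L , L-matching , L-avoids , L-covers = M ++ L , (P-matching , covers) , inj₁ ∘ MP.∈-++⁺ˡ
    where
    P-matching : IsMatching G (M ++ L)
    P-matching = AllP.++⁺ (proj₁ M-matching) (proj₁ L-matching)
               , subst Unique (≡.sym (V-++ M L))
                   (UP.++⁺ (proj₂ M-matching) (proj₂ L-matching)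
                      (λ (w∈M , w∈L) → All.lookup L-avoids w∈L (tabulate-∈ (inV M) (∈⇒inV M w∈M))))
    covers : ∀ w → w ∈ V (M ++ L)
    covers w with inV M w in w∈?
    ... | true  = subst (w ∈_) (≡.sym (V-++ M L)) (MP.∈-++⁺ˡ (inV⇒∈ M w∈?))
    ... | false = subst (w ∈_) (≡.sym (V-++ M L))
                    (MP.∈-++⁺ʳ (V M) (L-covers w (λ w∈S → ≡true⇒≢false (∈-tabulate (inV M) w∈S) w∈?)))

  module OutsideIndependent (T : Fin n → Bool) (T-independent : Independentᵇ T) (T-size : count T ≡ suc m) where
    W : Fin n → Bool
    W = not ∘ T
    open Region G W

    free+covered+T : ∀ {j} (mm : RegionMatching G W j) → count (Free mm) + 2 * j + suc m ≡ 2 * k + 2 * m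
    free+covered+T {j} mm = begin
      count (Free mm) + 2 * j + suc m  ≡⟨ cong (_+ suc m) (count-free mm) ⟩
      count W + suc m                  ≡⟨ +-comm (count W) (suc m) ⟩
      suc m + count W                  ≡⟨ cong (_+ count W) (≡.sym T-size) ⟩
      count T + count W                ≡⟨ ≡.trans (count-complement T) n≡2k+2m ⟩
      2 * k + 2 * m                    ∎
      where open ≡-Reasoning

    -- The m + 1 free vertices of a (k − 1)-matching outside T with no free edge are exactly the
    -- non-neighbours of each of them.
    module LastStep {j} (M : List (Pair n)) (M-matching : IsMatching G M) (M⊆W : All (λ w → W w ≡ true) (V M))
      (size : length M ≡ j) (1+j≡k : suc j ≡ k)
      (noFreeEdge : ∀ x y → free W M x ≡ true → free W M y ≡ true → adj′ x y ≡ false) where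

      count-free≡1+m : count (free W M) ≡ suc m
      count-free≡1+m = +-cancelʳ-≡ (2 * j) _ _ (+-cancelʳ-≡ (suc m) _ _ (begin
        count (free W M) + 2 * j + suc m  ≡⟨ free+covered+T (regionMatching M M-matching M⊆W size) ⟩
        2 * k + 2 * m                      ≡⟨ cong (λ t → 2 * t + 2 * m) (≡.sym 1+j≡k) ⟩
        2 * suc j + 2 * m                  ≡⟨ reorder m j ⟩
        suc m + 2 * j + suc m              ∎))
        where
        open ≡-Reasoning
        reorder : ∀ m j → 2 * suc j + 2 * m ≡ suc m + 2 * j + suc m
        reorder = solve-∀

      non-neighbour⇒free : ∀ x → free W M x ≡ true → ∀ w → not (adj′ x w) ≡ true → free W M w ≡ true
      non-neighbour⇒free x fx = ⊆∧count≥⇒⊇ (free W M) (not ∘ adj′ x)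
        (λ w fw → false⇒not-true (noFreeEdge x w fx fw))
        (subst (count (not ∘ adj′ x) ≤_) (≡.sym count-free≡1+m) (few-non-neighbours x))

      free-adjacent-to-V : ∀ x → free W M x ≡ true → ∀ w → w ∈ V M → adj′ x w ≡ true
      free-adjacent-to-V x fx w w∈M with adj′ x w in xw
      ... | true  = refl
      ... | false = ⊥-elim (free⇒∉V M (non-neighbour⇒free x fx w (false⇒not-true xw)) w∈M)

      two-free : ∃[ u ] ∃[ v ] (u ≢ v × free W M u ≡ true × free W M v ≡ true)
      two-free = count≥2⇒∃-distinct (free W M) (subst (2 ≤_) (≡.sym count-free≡1+m) (s≤s 1≤m))

      augmentThrough : ∀ {a b} → (a , b) ∈ M → RegionMatching G W (suc j)
      augmentThrough {a} {b} ab with two-free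
      ... | u , v , u≢v , fu , fv =
        augment3 (regionMatching M M-matching M⊆W size) fu fv u≢v (inj₁ ab)
          (free-adjacent-to-V u fu a (∈⇒∈V₁ ab)) (≡.trans (adj-sym b v) (free-adjacent-to-V v fv b (∈⇒∈V₂ ab)))

      -- For M = [] we have k = m = 1, and G is the join of T with two non-adjacent vertices.
      empty⇒join : length M ≡ 0 → Odd m × IsJoinOfTwoCliques G (2 * k) m
      empty⇒join M-empty with two-free
      ... | u , v , u≢v , fu , fv =
        (0 , m≡1) ,
        isJoinOfTwoCliques-intro (_== u) (_== v) (2 * k) m
          (λ x x==u → ≢⇒==-false {x = x} (u≢v ∘ ≡.trans (≡.sym (==⇒≡ x==u))))
          rest-size (≡.trans (count-singleton u) (≡.sym m≡1)) (≡.trans (count-singleton v) (≡.sym m≡1))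
          (λ x y x≢y x==u y==u → ⊥-elim (x≢y (≡.trans (==⇒≡ x==u) (≡.sym (==⇒≡ y==u)))))
          (λ x y x≢y x==v y==v → ⊥-elim (x≢y (≡.trans (==⇒≡ x==v) (≡.sym (==⇒≡ y==v)))))
          (λ x y x==u y==v → subst₂ (λ s t → adj′ s t ≡ false) (≡.sym (==⇒≡ x==u)) (≡.sym (==⇒≡ y==v)) (noFreeEdge u v fu fv))
          joined
        where
        m≡1 : m ≡ 1
        m≡1 = ≤-antisym (subst (m ≤_) (≡.trans (≡.sym 1+j≡k) (cong suc (≡.trans (≡.sym size) M-empty))) m≤k) 1≤m
        isEnd : Fin n → Bool
        isEnd w = (w == u) ∨ (w == v)
        free⇒end : ∀ w → free W M w ≡ true → isEnd w ≡ true
        free⇒end = ⊆∧count≥⇒⊇ isEnd (free W M) end⇒free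
          (≤-reflexive (≡.trans count-free≡1+m (≡.trans (cong suc m≡1) (≡.sym (count-pair u v u≢v)))))
          where
          end⇒free : ∀ w → isEnd w ≡ true → free W M w ≡ true
          end⇒free w end with ∨-true {w == u} end
          ... | inj₁ w==u = subst (λ t → free W M t ≡ true) (≡.sym (==⇒≡ w==u)) fu
          ... | inj₂ w==v = subst (λ t → free W M t ≡ true) (≡.sym (==⇒≡ w==v)) fv
        rest-size : count (λ x → not (x == u) ∧ not (x == v)) ≡ 2 * k
        rest-size = +-cancelˡ-≡ 2 _ _ (begin
          2 + count (λ x → not (x == u) ∧ not (x == v))  ≡⟨ cong₂ _+_ (≡.sym (count-pair u v u≢v))
                                                                      (count-cong _ _ (λ x → not-∨ (x == u) (x == v))) ⟩
          count isEnd + count (not ∘ isEnd)              ≡⟨ ≡.trans (count-complement isEnd) n≡2k+2m ⟩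
          2 * k + 2 * m                                  ≡⟨ cong (λ t → 2 * k + 2 * t) m≡1 ⟩
          2 * k + 2                                      ≡⟨ +-comm (2 * k) 2 ⟩
          2 + 2 * k                                      ∎)
          where
          open ≡-Reasoning
          not-∨ : ∀ a b → not a ∧ not b ≡ not (a ∨ b)
          not-∨ true  _ = refl
          not-∨ false _ = refl
        adjacent-off-ends : ∀ z → free W M z ≡ true → ∀ x → (x == u) ≡ false → (x == v) ≡ false → adj′ z x ≡ true
        adjacent-off-ends z free-z x x≢u x≢v with adj′ z x in zx
        ... | true  = refl
        ... | false = ⊥-elim (≡true⇒≢false (free⇒end x (non-neighbour⇒free z free-z x (false⇒not-true zx)))
                                            (cong₂ _∨_ x≢u x≢v))
        joined : ∀ x y → (x == u) ≡ false → (x == v) ≡ false → (y == u) ∨ (y == v) ≡ true → adj′ x y ≡ true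
        joined x y x≢u x≢v y-end with ∨-true {y == u} y-end
        ... | inj₁ y==u = subst (λ t → adj′ x t ≡ true) (≡.sym (==⇒≡ y==u))
                                (≡.trans (adj-sym x u) (adjacent-off-ends u fu x x≢u x≢v))
        ... | inj₂ y==v = subst (λ t → adj′ x t ≡ true) (≡.sym (==⇒≡ y==v))
                                (≡.trans (adj-sym x v) (adjacent-off-ends v fv x x≢u x≢v))

    lastStep-noFreeEdge : ∀ {j} M → IsMatching G M → All (λ w → W w ≡ true) (V M) → length M ≡ j → suc j ≡ k →
      (∀ x y → free W M x ≡ true → free W M y ≡ true → adj′ x y ≡ false) → RegionMatching G W (suc j)
    lastStep-noFreeEdge []      M-matching M⊆W size 1+j≡k noFreeEdge =
      ⊥-elim (notJoin (LastStep.empty⇒join [] M-matching M⊆W size 1+j≡k noFreeEdge refl))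
    lastStep-noFreeEdge (e ∷ M) M-matching M⊆W size 1+j≡k noFreeEdge =
      LastStep.augmentThrough (e ∷ M) M-matching M⊆W size 1+j≡k noFreeEdge (here refl)

    lastStep : ∀ {j} (mm : RegionMatching G W j) → suc j ≡ k → RegionMatching G W (suc j)
    lastStep mm@(regionMatching M M-matching M⊆W size) 1+j≡k with freeEdge? M
    ... | yes (x , y , fx , fy , xy) = extendByEdge mm fx fy xy
    ... | no no-free-edge =
      lastStep-noFreeEdge M M-matching M⊆W size 1+j≡k (λ x y fx fy → ¬-not (λ xy → no-free-edge (x , y , fx , fy , xy)))

    kMatchingOutside : RegionMatching G W k
    kMatchingOutside = grow k ≤-refl
      where
      grow : ∀ j → j ≤ k → RegionMatching G W j
      grow zero    _   = emptyMatching
      grow (suc j) j<k with suc (suc j) ≤? k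
      ... | no  j+1≮k = lastStep (grow j (≤-trans (n≤1+n j) j<k)) (≤-antisym j<k (s≤s⁻¹ (≰⇒> j+1≮k)))
      ... | yes j+1<k = greedyStep mm (+-cancelʳ-≤ (2 * j) _ _ (+-cancelʳ-≤ (suc m) _ _ (begin
        2 + m + 2 * j + suc m                  ≤⟨ n≤1+n _ ⟩
        suc (2 + m + 2 * j + suc m)            ≡⟨ reorder m j ⟩
        2 * suc (suc j) + 2 * m                ≤⟨ +-monoˡ-≤ (2 * m) (*-monoʳ-≤ 2 j+1<k) ⟩
        2 * k + 2 * m                          ≡⟨ ≡.sym (free+covered+T mm) ⟩
        count (Free mm) + 2 * j + suc m        ∎)))
        where
        open ≤-Reasoning
        mm = grow j (≤-trans (n≤1+n j) j<k)
        reorder : ∀ m j → suc (2 + m + 2 * j + suc m) ≡ 2 * suc (suc j) + 2 * m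
        reorder = solve-∀

    -- Each vertex of T needs a partner in W ∖ V(M), which has only m − 1 vertices.
    no-extension : ¬ (∃[ P ] (IsPerfectMatching G P × _⊆ₘ_ G (edges kMatchingOutside) P))
    no-extension (P , (P-matching , P-covers) , M⊆P) = 1+n≰n (≤-trans (n≤1+n _) (begin
      2 + (2 * k + 2 * m)             ≡⟨ reorder m k ⟩
      suc m + (2 * k + suc m)         ≤⟨ +-monoʳ-≤ (suc m) (+-monoʳ-≤ (2 * k) (subst (_≤ count R) T-size T≤R)) ⟩
      suc m + (2 * k + count R)       ≡⟨ cong₂ _+_ (≡.sym T-size) (≡.trans (cong (_+ count R) (≡.sym (count-covered mm)))
                                                                          (≡.sym (count-split W (inV M)))) ⟩
      count T + count W               ≡⟨ ≡.trans (count-complement T) n≡2k+2m ⟩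
      2 * k + 2 * m                   ∎))
      where
      open ≤-Reasoning
      reorder : ∀ m k → 2 + (2 * k + 2 * m) ≡ suc m + (2 * k + suc m)
      reorder = solve-∀
      mm = kMatchingOutside
      M = edges mm
      R : Fin n → Bool
      R w = W w ∧ not (inV M w)
      partner∉M : ∀ {a b} → (a , b) ∈ᵒ P → T a ≡ true → inV M b ≡ false
      partner∉M {a} {b} ab Ta with inV M b in b∈?
      ... | false = refl
      ... | true with ∈V⇒partner M (inV⇒∈ M b∈?)
      ...   | c , cb = ⊥-elim (≡true⇒≢false Ta (not-true⇒false (All.lookup (RegionMatching.inRegion mm)
                         (subst (_∈ V M) (≡.sym (partner-unique P (proj₂ P-matching) (∈ᵒ-flip ab) (toP (∈ᵒ-flip cb))))
                                (∈ᵒ⇒∈V₁ cb)))))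
        where
        toP : ∀ {x y} → (x , y) ∈ᵒ M → (x , y) ∈ᵒ P
        toP (inj₁ xy) = M⊆P xy
        toP (inj₂ yx) = ∈ᵒ-flip (M⊆P yx)
      T-to-R : ∀ e → e ∈ P → toℕ (T (proj₁ e)) + toℕ (T (proj₂ e)) ≤ toℕ (R (proj₁ e)) + toℕ (R (proj₂ e))
      T-to-R (a , b) ab with T a in Ta | T b in Tb
      ... | true  | true  = ⊥-elim (≡true⇒≢false (All.lookup (proj₁ P-matching) ab) (T-independent a b Ta Tb))
      ... | true  | false rewrite partner∉M (inj₁ ab) Ta = s≤s z≤n
      ... | false | true  rewrite partner∉M (inj₂ ab) Tb = s≤s z≤n
      ... | false | false = z≤n
      T≤R : count T ≤ count R
      T≤R = begin
        count T                 ≤⟨ ⊆⇒count≤countL T (V P) (λ w _ → P-covers w) ⟩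
        countL T (V P)          ≡⟨ countL-V G T P ⟩
        sumMap _ P              ≤⟨ sumMap-mono _ _ P T-to-R ⟩
        sumMap _ P              ≡⟨ ≡.sym (countL-V G R P) ⟩
        countL R (V P)          ≤⟨ unique⇒countL≤count R (V P) (proj₂ P-matching) ⟩
        count R                 ∎

  extensions⇒α≤ : Extensions → IndependenceNumberAtMost G m
  extensions⇒α≤ extends = no-large-independent⇒α≤ λ T T-independent T-size →
    let open OutsideIndependent T T-independent T-size
    in no-extension (extends (edges kMatchingOutside) (RegionMatching.isMatching kMatchingOutside)
                             (RegionMatching.size kMatchingOutside))

  extendable⇒α≤ : Extendable G k → IndependenceNumberAtMost G m
  extendable⇒α≤ (_ , _ , extends) = extensions⇒α≤ extends

  factorCritical⇒α≤ : FactorCritical G (2 * k) → IndependenceNumberAtMost G m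
  factorCritical⇒α≤ = extensions⇒α≤ ∘ factorCritical⇒extensions

  α≤⇒extendable : Connected G → IndependenceNumberAtMost G m → Extendable G k
  α≤⇒extendable connected α =
    connected
    , (edges kMatching , RegionMatching.isMatching kMatching , RegionMatching.size kMatching)
    , factorCritical⇒extensions (α≤⇒factorCritical α)

minDegree⇒few-non-neighbours : ∀ {n} (G : Graph n) d m → n ≤ d + suc m → MinDegreeAtLeast G d →
                               ∀ v → count (not ∘ adj G v) ≤ suc m
minDegree⇒few-non-neighbours {n} G d m n≤d+1+m min-degree v = +-cancelˡ-≤ d _ _ (begin
  d + count (not ∘ adj G v)              ≤⟨ +-monoˡ-≤ _ (subst (d ≤_) (∣tabulate∣≡count (adj G v)) (min-degree v)) ⟩
  count (adj G v) + count (not ∘ adj G v) ≡⟨ count-complement (adj G v) ⟩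
  n                                      ≤⟨ n≤d+1+m ⟩
  d + suc m                              ∎)
  where open ≤-Reasoning

hypotheses⇒parameters : ∀ ν h k → ν ≡ 2 * h → 1 ≤ k → ν ≤ 4 * k → k + 1 ≤ h →
  ν ≡ 2 * k + 2 * (h ∸ k) × 1 ≤ h ∸ k × h ∸ k ≤ k × ν ≤ (h + k ∸ 1) + suc (h ∸ k)
hypotheses⇒parameters ν h k@(suc k′) ν≡2h (s≤s z≤n) ν≤4k k+1≤h = ν≡2k+2m , 1≤m , m≤k , ν≤degree+1+m
  where
  m : ℕ
  m = h ∸ k
  h≡m+k : h ≡ m + k
  h≡m+k = ≡.sym (m∸n+n≡m (≤-trans (m≤m+n k 1) k+1≤h))
  2[m+k]≡2k+2m : ∀ m k → 2 * (m + k) ≡ 2 * k + 2 * m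
  2[m+k]≡2k+2m = solve-∀
  2[m+k]≡[m+k+k′]+1+m : ∀ m k′ → 2 * (m + suc k′) ≡ (m + suc k′ + k′) + suc m
  2[m+k]≡[m+k+k′]+1+m = solve-∀
  4k≡2k+2k : ∀ k → 4 * k ≡ 2 * k + 2 * k
  4k≡2k+2k = solve-∀
  ν≡2k+2m : ν ≡ 2 * k + 2 * m
  ν≡2k+2m = ≡.trans ν≡2h (≡.trans (cong (2 *_) h≡m+k) (2[m+k]≡2k+2m m k))
  1≤m : 1 ≤ m
  1≤m = +-cancelʳ-≤ k 1 m (subst₂ _≤_ (+-comm k 1) h≡m+k k+1≤h)
  m≤k : m ≤ k
  m≤k = *-cancelˡ-≤ 2 (+-cancelˡ-≤ (2 * k) (2 * m) (2 * k) (subst₂ _≤_ ν≡2k+2m (4k≡2k+2k k) ν≤4k))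
  ν≤degree+1+m : ν ≤ (h + k ∸ 1) + suc m
  ν≤degree+1+m = ≤-reflexive (begin
    ν                         ≡⟨ ν≡2h ⟩
    2 * h                     ≡⟨ cong (2 *_) h≡m+k ⟩
    2 * (m + k)               ≡⟨ 2[m+k]≡[m+k+k′]+1+m m k′ ⟩
    (m + k + k′) + suc m      ≡⟨ cong (λ t → t + k′ + suc m) (≡.sym h≡m+k) ⟩
    (h + k′) + suc m          ≡⟨ cong (λ t → t ∸ 1 + suc m) (≡.sym (+-suc h k′)) ⟩
    (h + k ∸ 1) + suc m       ∎)
    where open ≡-Reasoning

corollary1 : (ν h k : ℕ) (G : Graph ν) → Connected G → ν ≡ 2 * h
    → 1 ≤ k → ν ≤ 4 * k → k + 1 ≤ h
    → MinDegreeAtLeast G (h + k ∸ 1)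
    → ¬ (Odd (h ∸ k) × IsJoinOfTwoCliques G (2 * k) (h ∸ k))
    → (Extendable G k → FactorCritical G (2 * k))
    × (FactorCritical G (2 * k) → IndependenceNumberAtMost G (h ∸ k))
    × (IndependenceNumberAtMost G (h ∸ k) → Extendable G k)
corollary1 ν h k G connected ν≡2h 1≤k ν≤4k k+1≤h min-degree notJoin
  with hypotheses⇒parameters ν h k ν≡2h 1≤k ν≤4k k+1≤h
... | ν≡2k+2m , 1≤m , m≤k , ν≤degree+1+m =
  E.α≤⇒factorCritical ∘ E.extendable⇒α≤ , E.factorCritical⇒α≤ , E.α≤⇒extendable connected
  where
  few-non-neighbours : ∀ v → count (not ∘ adj G v) ≤ suc (h ∸ k)
  few-non-neighbours = minDegree⇒few-non-neighbours G (h + k ∸ 1) (h ∸ k) ν≤degree+1+m min-degree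
  module E = Equivalences G k (h ∸ k) few-non-neighbours ν≡2k+2m 1≤m m≤k notJoin
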